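{- Let $d=2m$ with $m\ge3$ odd, and let $f=a_1x_1^d+\dots+a_sx_s^d$ be an additive form over $K=\mathbb{Q}_2(\sqrt5)$. Suppose there is a level $k\in\mathbb Z/d\mathbb Z$ and a class $c\in\mathbb F_4^\times$ such that at least $6$ variables of level $k$ have class $c$, and level $k+1$ contains at least $1$ variable. Then $f$ has a nontrivial zero in $K$.
   Context: $K=\mathbb{Q}_2(\sqrt5)$ has ring of integers $\mathcal O=\mathbb Z_2[\alpha]$, $\alpha=(1+\sqrt5)/2$; $2$ is a uniformizer and $\mathcal O/2\mathcal O\cong\mathbb F_4$. A nontrivial zero is $(x_1,\dots,x_s)\in K^s\setminus\{0\}$ with $f=0$. For a variable $x_i$ with $a_i\neq0$ write $a_i=2^{v_i}u_i$ with $v_i\in\mathbb Z$, $u_i\in\mathcal O^\times$. The level of $x_i$ is $v_i\bmod d\in\mathbb Z/d\mathbb Z$ and its class is the image of $u_i$ in $\mathbb F_4^\times$. Only variables with nonzero coefficient are assigned levels and counted. -}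

module Defs where

-- Model of K = Q₂(√5) built from scratch (agda-stdlib has no p-adic numbers).
--  * ZA      : the ring ℤ[α], α = (1+√5)/2, α² = α + 1, elements (a , b) ↦ a + bα.
--  * Seq     : sequences ℕ → ZA; an element of 𝒪 = ℤ₂[α] = lim ℤ[α]/2ⁿ is a
--              *coherent* sequence (IsO), the n-th term being its class mod 2ⁿ.

open import Data.Nat as ℕ using (ℕ; zero; suc)
open import Data.Integer as ℤ using (ℤ; +_; -[1+_])
open import Data.Integer.Divisibility using (_∣_)
open import Data.Product using (_×_; _,_; Σ; ∃; proj₁; proj₂)
open import Data.Fin using (Fin) renaming (zero to fzero; suc to fsuc)
open import Relation.Nullary using (¬_)

ZA : Set
ZA = ℤ × ℤ

_+ᴬ_ : ZA → ZA → ZA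
(a , b) +ᴬ (c , e) = (a ℤ.+ c , b ℤ.+ e)

_*ᴬ_ : ZA → ZA → ZA
(a , b) *ᴬ (c , e) = (a ℤ.* c ℤ.+ b ℤ.* e , a ℤ.* e ℤ.+ b ℤ.* c ℤ.+ b ℤ.* e)

0ᴬ 1ᴬ : ZA
0ᴬ = (+ 0 , + 0)
1ᴬ = (+ 1 , + 0)

_≡_[modᴬ_] : ZA → ZA → ℤ → Set
(a , b) ≡ (c , e) [modᴬ N ] = (N ∣ a ℤ.- c) × (N ∣ b ℤ.- e)

two^ : ℕ → ℤ
two^ n = + (2 ℕ.^ n)

Seq : Set
Seq = ℕ → ZA

IsO : Seq → Set
IsO x = ∀ n → x (suc n) ≡ x n [modᴬ two^ n ]

_≈O_ : Seq → Seq → Set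
x ≈O y = ∀ n → x n ≡ y n [modᴬ two^ n ]

_+O_ _*O_ : Seq → Seq → Seq
(x +O y) n = x n +ᴬ y n
(x *O y) n = x n *ᴬ y n

constO : ZA → Seq
constO c n = c

0O 1O : Seq
0O = constO 0ᴬ
1O = constO 1ᴬ

2^O : ℕ → Seq
2^O k = constO (two^ k , + 0)

IsUnitO : Seq → Set
IsUnitO u = Σ Seq λ w → IsO w × ((u *O w) ≈O 1O)

record K : Set where
  constructor _/2^_
  field
    num : Seq
    den : ℕ
open K public

IsK : K → Set
IsK x = IsO (num x)

_≈K_ : K → K → Set
x ≈K y = (2^O (den y) *O num x) ≈O (2^O (den x) *O num y)

_+K_ _*K_ : K → K → K
x +K y = ((2^O (den y) *O num x) +O (2^O (den x) *O num y)) /2^ (den x ℕ.+ den y)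
x *K y = (num x *O num y) /2^ (den x ℕ.+ den y)

0K 1K : K
0K = 0O /2^ 0
1K = 1O /2^ 0

ιK : Seq → K
ιK u = u /2^ 0

pow2K : ℤ → K
pow2K (+ n) = 2^O n /2^ 0
pow2K -[1+ n ] = 1O /2^ (suc n)

_^K_ : K → ℕ → K
x ^K zero = 1K
x ^K suc n = x *K (x ^K n)

sumK : (s : ℕ) → (Fin s → K) → K
sumK zero f = 0K
sumK (suc s) f = f fzero +K sumK s (λ i → f (fsuc i))

form : (d s : ℕ) → (Fin s → K) → (Fin s → K) → K
form d s a x = sumK s (λ i → a i *K (x i ^K d))

HasLevel : (d : ℕ) → K → ℤ → Set
HasLevel d a k = ¬ (a ≈K 0K) × Σ ℤ λ v → Σ Seq λ u →
  IsO u × IsUnitO u × (a ≈K (pow2K v *K ιK u)) × ((+ d) ∣ (v ℤ.- k))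

-- same, and additionally the class of u in 𝔽₄^× = (𝒪/2𝒪)^× is c
-- (u 1 is the residue of u modulo 2¹)
HasLevelClass : (d : ℕ) → K → ℤ → ZA → Set
HasLevelClass d a k c = ¬ (a ≈K 0K) × Σ ℤ λ v → Σ Seq λ u →
  IsO u × IsUnitO u × (a ≈K (pow2K v *K ιK u)) × ((+ d) ∣ (v ℤ.- k))
  × (u 1 ≡ c [modᴬ + 2 ])

-- Write every coefficient as 2^v U with U a unit of 𝒪. Dividing the six coefficients of level k
-- by a unit representing their common class makes them ≡ 1 (mod 2). Grouping them in pairs of
-- equal α-coordinate modulo 4, together with the term 2w of the variable of level k + 1, a linear
-- dependence over 𝔽₂ gives values y ∈ {0, 1, √5}, not all 0, with ∑ U y^d ≡ 0 (mod 8): indeed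
-- y^d ≡ 0, 1, 5 (mod 8) as d = 2m with m odd. Because the derivative of y^d then has valuation
-- exactly 1, Hensel's lemma lifts the congruence modulo 8 to an exact zero in 𝒪 for one odd
-- value, and dividing each variable by a suitable power of 2 turns it into a zero of f.

module Submission where

open import Defs
open import Data.Nat using (ℕ; _≤_; _%_; _*_)
open import Data.Integer using (ℤ; +_) renaming (_+_ to _+ℤ_)
open import Data.Fin using (Fin)
open import Data.Product using (_×_; ∃)
open import Function.Definitions using (Injective)
open import Relation.Binary.PropositionalEquality using (_≡_)
open import Relation.Nullary using (¬_)

open import Data.Nat as ℕ using (zero; suc)
import Data.Nat.Properties as ℕP
import Data.Nat.DivMod as ℕDM
import Data.Nat.Tactic.RingSolver as ℕSolver
open import Data.Integer as ℤ using (-[1+_])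
import Data.Integer.Properties as ℤP
import Data.Integer.DivMod as ℤDM
open import Data.Integer.Divisibility using (_∣_)
import Data.Integer.Divisibility.Signed as ℤS
open import Data.Integer.Tactic.RingSolver using (solve-∀)
open import Data.Bool using (Bool; true; false; _∧_; _∨_)
open import Data.Fin using (_≟_) renaming (zero to fzero; suc to fsuc)
import Data.Fin.Properties as FinP
open import Data.Product using (_,_; Σ; proj₁; proj₂)
open import Data.Empty using (⊥; ⊥-elim)
open import Data.Maybe using (Maybe; nothing; just)
open import Data.Unit using (tt)
open import Level using (0ℓ)
open import Relation.Binary.PropositionalEquality
  using (refl; sym; trans; cong; cong₂; subst; subst₂; isEquivalence; module ≡-Reasoning)
open import Relation.Binary using (tri<; tri≈; tri>)
open import Relation.Nullary using (Dec; yes; no)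
open import Relation.Nullary.Decidable using (True; toWitness; _→-dec_; ¬?)
open import Algebra.Structures {A = ZA} _≡_ using (IsCommutativeRing)
open import Algebra.Bundles using (CommutativeRing)
import Algebra.Solver.Ring.AlmostCommutativeRing as ACR

infixl 6 _⊕_
infixl 7 _⊗_

-- Opaque copies of the operations of Defs: the ring solver and unification
-- must treat them as atoms instead of unfolding them into integer arithmetic.
opaque
  _⊕_ _⊗_ : ZA → ZA → ZA
  x ⊕ y = x +ᴬ y
  x ⊗ y = x *ᴬ y

  -ᴬ_ : ZA → ZA
  -ᴬ (a , b) = (ℤ.- a , ℤ.- b)

opaque
  unfolding _⊕_ _⊗_

  ⊕-def : ∀ x y → x ⊕ y ≡ x +ᴬ y
  ⊕-def x y = refl

  ⊗-def : ∀ x y → x ⊗ y ≡ x *ᴬ y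
  ⊗-def x y = refl

pair≡ : ∀ {a b c e : ℤ} → a ≡ c → b ≡ e → (a , b) ≡ (c , e)
pair≡ refl refl = refl

opaque
  unfolding _⊕_ _⊗_ -ᴬ_

  ZA-isCommutativeRing : IsCommutativeRing _⊕_ _⊗_ -ᴬ_ 0ᴬ 1ᴬ
  ZA-isCommutativeRing = record
    { isRing = record
      { +-isAbelianGroup = record
        { isGroup = record
          { isMonoid = record
            { isSemigroup = record
              { isMagma = record { isEquivalence = isEquivalence ; ∙-cong = cong₂ _⊕_ }
              ; assoc = λ { (a , b) (c , e) (f , g) → pair≡ (ℤP.+-assoc a c f) (ℤP.+-assoc b e g) } }
            ; identity = (λ { (a , b) → pair≡ (ℤP.+-identityˡ a) (ℤP.+-identityˡ b) })
                       , (λ { (a , b) → pair≡ (ℤP.+-identityʳ a) (ℤP.+-identityʳ b) }) }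
          ; inverse = (λ { (a , b) → pair≡ (ℤP.+-inverseˡ a) (ℤP.+-inverseˡ b) })
                    , (λ { (a , b) → pair≡ (ℤP.+-inverseʳ a) (ℤP.+-inverseʳ b) })
          ; ⁻¹-cong = cong -ᴬ_ }
        ; comm = λ { (a , b) (c , e) → pair≡ (ℤP.+-comm a c) (ℤP.+-comm b e) } }
      ; *-cong = cong₂ _⊗_
      ; *-assoc = λ { (a , b) (c , e) (f , g) → pair≡ (*-assoc₁ a b c e f g) (*-assoc₂ a b c e f g) }
      ; *-identity = (λ { (a , b) → pair≡ (*-identityˡ₁ a b) (*-identityˡ₂ a b) })
                   , (λ { (a , b) → pair≡ (*-identityʳ₁ a b) (*-identityʳ₂ a b) })
      ; distrib = (λ { (a , b) (c , e) (f , g) → pair≡ (distribˡ₁ a b c e f g) (distribˡ₂ a b c e f g) })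
                , (λ { (a , b) (c , e) (f , g) → pair≡ (distribʳ₁ a b c e f g) (distribʳ₂ a b c e f g) }) }
    ; *-comm = λ { (a , b) (c , e) → pair≡ (*-comm₁ a b c e) (*-comm₂ a b c e) } }
    where
    *-assoc₁ : ∀ a b c e f g → (a ℤ.* c ℤ.+ b ℤ.* e) ℤ.* f ℤ.+ (a ℤ.* e ℤ.+ b ℤ.* c ℤ.+ b ℤ.* e) ℤ.* g
                             ≡ a ℤ.* (c ℤ.* f ℤ.+ e ℤ.* g) ℤ.+ b ℤ.* (c ℤ.* g ℤ.+ e ℤ.* f ℤ.+ e ℤ.* g)
    *-assoc₁ = solve-∀
    *-assoc₂ : ∀ a b c e f g → (a ℤ.* c ℤ.+ b ℤ.* e) ℤ.* g ℤ.+ (a ℤ.* e ℤ.+ b ℤ.* c ℤ.+ b ℤ.* e) ℤ.* f ℤ.+ (a ℤ.* e ℤ.+ b ℤ.* c ℤ.+ b ℤ.* e) ℤ.* g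
                             ≡ a ℤ.* (c ℤ.* g ℤ.+ e ℤ.* f ℤ.+ e ℤ.* g) ℤ.+ b ℤ.* (c ℤ.* f ℤ.+ e ℤ.* g) ℤ.+ b ℤ.* (c ℤ.* g ℤ.+ e ℤ.* f ℤ.+ e ℤ.* g)
    *-assoc₂ = solve-∀
    *-identityˡ₁ : ∀ a b → + 1 ℤ.* a ℤ.+ + 0 ℤ.* b ≡ a
    *-identityˡ₁ = solve-∀
    *-identityˡ₂ : ∀ a b → + 1 ℤ.* b ℤ.+ + 0 ℤ.* a ℤ.+ + 0 ℤ.* b ≡ b
    *-identityˡ₂ = solve-∀
    *-identityʳ₁ : ∀ a b → a ℤ.* + 1 ℤ.+ b ℤ.* + 0 ≡ a
    *-identityʳ₁ = solve-∀
    *-identityʳ₂ : ∀ a b → a ℤ.* + 0 ℤ.+ b ℤ.* + 1 ℤ.+ b ℤ.* + 0 ≡ b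
    *-identityʳ₂ = solve-∀
    distribˡ₁ : ∀ a b c e f g → a ℤ.* (c ℤ.+ f) ℤ.+ b ℤ.* (e ℤ.+ g) ≡ (a ℤ.* c ℤ.+ b ℤ.* e) ℤ.+ (a ℤ.* f ℤ.+ b ℤ.* g)
    distribˡ₁ = solve-∀
    distribˡ₂ : ∀ a b c e f g → a ℤ.* (e ℤ.+ g) ℤ.+ b ℤ.* (c ℤ.+ f) ℤ.+ b ℤ.* (e ℤ.+ g)
                              ≡ (a ℤ.* e ℤ.+ b ℤ.* c ℤ.+ b ℤ.* e) ℤ.+ (a ℤ.* g ℤ.+ b ℤ.* f ℤ.+ b ℤ.* g)
    distribˡ₂ = solve-∀
    distribʳ₁ : ∀ a b c e f g → (c ℤ.+ f) ℤ.* a ℤ.+ (e ℤ.+ g) ℤ.* b ≡ (c ℤ.* a ℤ.+ e ℤ.* b) ℤ.+ (f ℤ.* a ℤ.+ g ℤ.* b)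
    distribʳ₁ = solve-∀
    distribʳ₂ : ∀ a b c e f g → (c ℤ.+ f) ℤ.* b ℤ.+ (e ℤ.+ g) ℤ.* a ℤ.+ (e ℤ.+ g) ℤ.* b
                              ≡ (c ℤ.* b ℤ.+ e ℤ.* a ℤ.+ e ℤ.* b) ℤ.+ (f ℤ.* b ℤ.+ g ℤ.* a ℤ.+ g ℤ.* b)
    distribʳ₂ = solve-∀
    *-comm₁ : ∀ a b c e → a ℤ.* c ℤ.+ b ℤ.* e ≡ c ℤ.* a ℤ.+ e ℤ.* b
    *-comm₁ = solve-∀
    *-comm₂ : ∀ a b c e → a ℤ.* e ℤ.+ b ℤ.* c ℤ.+ b ℤ.* e ≡ c ℤ.* b ℤ.+ e ℤ.* a ℤ.+ e ℤ.* b
    *-comm₂ = solve-∀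

ZA-commutativeRing : CommutativeRing 0ℓ 0ℓ
ZA-commutativeRing = record { isCommutativeRing = ZA-isCommutativeRing }

open CommutativeRing ZA-commutativeRing public
  using ()
  renaming ( zeroˡ to ⊗-zeroˡ; zeroʳ to ⊗-zeroʳ; *-identityˡ to ⊗-identityˡ; *-identityʳ to ⊗-identityʳ
           ; +-identityˡ to ⊕-identityˡ; +-identityʳ to ⊕-identityʳ; *-assoc to ⊗-assoc; *-comm to ⊗-comm
           ; +-comm to ⊕-comm)

fromℤ : ℤ → ZA
fromℤ N = (N , + 0)

opaque
  unfolding _⊕_ _⊗_ -ᴬ_

  fromℤ-+ : ∀ a b → fromℤ (a ℤ.+ b) ≡ fromℤ a ⊕ fromℤ b
  fromℤ-+ a b = refl

  fromℤ-* : ∀ a b → fromℤ (a ℤ.* b) ≡ fromℤ a ⊗ fromℤ b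
  fromℤ-* a b = pair≡ (fst a b) (snd a b)
    where
    fst : ∀ a b → a ℤ.* b ≡ a ℤ.* b ℤ.+ + 0 ℤ.* + 0
    fst = solve-∀
    snd : ∀ a b → + 0 ≡ a ℤ.* + 0 ℤ.+ + 0 ℤ.* b ℤ.+ + 0 ℤ.* + 0
    snd = solve-∀

  fromℤ-neg : ∀ a → fromℤ (ℤ.- a) ≡ -ᴬ fromℤ a
  fromℤ-neg a = refl

  fromℤ-*-components : ∀ n a b → fromℤ n ⊗ (a , b) ≡ (n ℤ.* a , n ℤ.* b)
  fromℤ-*-components n a b = pair≡ (fst n a b) (snd n a b)
    where
    fst : ∀ n a b → n ℤ.* a ℤ.+ + 0 ℤ.* b ≡ n ℤ.* a
    fst = solve-∀
    snd : ∀ n a b → n ℤ.* b ℤ.+ + 0 ℤ.* a ℤ.+ + 0 ℤ.* b ≡ n ℤ.* b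
    snd = solve-∀

  ⊕-components : ∀ a b c e → (a , b) ⊕ (c , e) ≡ (a ℤ.+ c , b ℤ.+ e)
  ⊕-components a b c e = refl

ZA-almostCommutativeRing : ACR.AlmostCommutativeRing 0ℓ 0ℓ
ZA-almostCommutativeRing = ACR.fromCommutativeRing ZA-commutativeRing

fromℤ-morphism : ℤ.+-*-rawRing ACR.-Raw-AlmostCommutative⟶ ZA-almostCommutativeRing
fromℤ-morphism = record
  { ⟦_⟧ = fromℤ ; +-homo = fromℤ-+ ; *-homo = fromℤ-* ; -‿homo = fromℤ-neg ; 0-homo = refl ; 1-homo = refl }

fromℤ-≟ : ∀ a b → Maybe (fromℤ a ≡ fromℤ b)
fromℤ-≟ a b with a ℤ.≟ b
... | yes refl = just refl
... | no _ = nothing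

open import Algebra.Solver.Ring ℤ.+-*-rawRing ZA-almostCommutativeRing fromℤ-morphism fromℤ-≟
  using (solve; _:=_; con; _:+_; _:*_; :-_)

infix 4 _≈[_]_
record _≈[_]_ (x : ZA) (N : ℤ) (y : ZA) : Set where
  constructor _,_
  field
    quotient : ZA
    equation : x ≡ y ⊕ fromℤ N ⊗ quotient

≈-refl : ∀ {x N} → x ≈[ N ] x
≈-refl {x} {N} = 0ᴬ , sym (trans (cong (x ⊕_) (⊗-zeroʳ (fromℤ N))) (⊕-identityʳ x))

≈-reflexive : ∀ {x y N} → x ≡ y → x ≈[ N ] y
≈-reflexive refl = ≈-refl

≈-sym : ∀ {x y N} → x ≈[ N ] y → y ≈[ N ] x
≈-sym {x} {y} {N} (q , refl) = (-ᴬ q) , cancel y (fromℤ N) q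
  where
  cancel : ∀ y n q → y ≡ y ⊕ n ⊗ q ⊕ n ⊗ (-ᴬ q)
  cancel = solve 3 (λ y n q → y := y :+ n :* q :+ n :* (:- q)) refl

≈-trans : ∀ {x y z N} → x ≈[ N ] y → y ≈[ N ] z → x ≈[ N ] z
≈-trans {z = z} {N} (q , refl) (r , refl) = (q ⊕ r) , regroup z (fromℤ N) q r
  where
  regroup : ∀ z n q r → z ⊕ n ⊗ r ⊕ n ⊗ q ≡ z ⊕ n ⊗ (q ⊕ r)
  regroup = solve 4 (λ z n q r → z :+ n :* r :+ n :* q := z :+ n :* (q :+ r)) refl

⊕-cong : ∀ {x x' y y' N} → x ≈[ N ] x' → y ≈[ N ] y' → x ⊕ y ≈[ N ] x' ⊕ y'
⊕-cong {x' = x'} {y' = y'} {N} (q , refl) (r , refl) = (q ⊕ r) , regroup x' y' (fromℤ N) q r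
  where
  regroup : ∀ x y n q r → x ⊕ n ⊗ q ⊕ (y ⊕ n ⊗ r) ≡ x ⊕ y ⊕ n ⊗ (q ⊕ r)
  regroup = solve 5 (λ x y n q r → x :+ n :* q :+ (y :+ n :* r) := x :+ y :+ n :* (q :+ r)) refl

-ᴬ-cong : ∀ {x x' N} → x ≈[ N ] x' → -ᴬ x ≈[ N ] -ᴬ x'
-ᴬ-cong {x' = x'} {N} (q , refl) = (-ᴬ q) , distrib x' (fromℤ N) q
  where
  distrib : ∀ x n q → -ᴬ (x ⊕ n ⊗ q) ≡ -ᴬ x ⊕ n ⊗ (-ᴬ q)
  distrib = solve 3 (λ x n q → :- (x :+ n :* q) := :- x :+ n :* (:- q)) refl

⊗-cong : ∀ {x x' y y' N} → x ≈[ N ] x' → y ≈[ N ] y' → x ⊗ y ≈[ N ] x' ⊗ y'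
⊗-cong {x' = x'} {y' = y'} {N} (q , refl) (r , refl) =
  (q ⊗ y' ⊕ x' ⊗ r ⊕ fromℤ N ⊗ q ⊗ r) , expand x' y' (fromℤ N) q r
  where
  expand : ∀ x y n q r → (x ⊕ n ⊗ q) ⊗ (y ⊕ n ⊗ r) ≡ x ⊗ y ⊕ n ⊗ (q ⊗ y ⊕ x ⊗ r ⊕ n ⊗ q ⊗ r)
  expand = solve 5 (λ x y n q r →
    (x :+ n :* q) :* (y :+ n :* r) := x :* y :+ n :* (q :* y :+ x :* r :+ n :* q :* r)) refl

⊗-congˡ : ∀ {x y N} c → x ≈[ N ] y → c ⊗ x ≈[ N ] c ⊗ y
⊗-congˡ c = ⊗-cong (≈-refl {c})

≈-divisor : ∀ {x y} N M → x ≈[ N ℤ.* M ] y → x ≈[ N ] y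
≈-divisor {y = y} N M (q , refl) =
  (fromℤ M ⊗ q) , trans (cong (λ t → y ⊕ t ⊗ q) (fromℤ-* N M)) (cong (y ⊕_) (⊗-assoc (fromℤ N) (fromℤ M) q))

fromℤ-cancelˡ : ∀ (A : ℤ) .{{_ : ℤ.NonZero A}} x y → fromℤ A ⊗ x ≡ fromℤ A ⊗ y → x ≡ y
fromℤ-cancelˡ A (a , b) (c , e) eq =
  pair≡ (ℤP.*-cancelˡ-≡ A a c (cong proj₁ eq′)) (ℤP.*-cancelˡ-≡ A b e (cong proj₂ eq′))
  where
  eq′ : (A ℤ.* a , A ℤ.* b) ≡ (A ℤ.* c , A ℤ.* e)
  eq′ = trans (sym (fromℤ-*-components A a b)) (trans eq (fromℤ-*-components A c e))

≈-cancelˡ : ∀ {x y N} M .{{_ : ℤ.NonZero M}} → fromℤ M ⊗ x ≈[ M ℤ.* N ] fromℤ M ⊗ y → x ≈[ N ] y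
≈-cancelˡ {x} {y} {N} M (q , e) = q , fromℤ-cancelˡ M x (y ⊕ fromℤ N ⊗ q)
  (trans e (trans (cong (λ t → fromℤ M ⊗ y ⊕ t ⊗ q) (fromℤ-* M N)) (factor y (fromℤ M) (fromℤ N) q)))
  where
  factor : ∀ y m n q → m ⊗ y ⊕ m ⊗ n ⊗ q ≡ m ⊗ (y ⊕ n ⊗ q)
  factor = solve 4 (λ y m n q → m :* y :+ m :* n :* q := m :* (y :+ n :* q)) refl

≈-components : ∀ {x y N} → x ≈[ N ] y →
  Σ ℤ λ q₁ → Σ ℤ λ q₂ → x ≡ (proj₁ y ℤ.+ N ℤ.* q₁ , proj₂ y ℤ.+ N ℤ.* q₂)
≈-components {y = y} {N} ((q₁ , q₂) , e) =
  q₁ , q₂ , trans e (trans (cong (y ⊕_) (fromℤ-*-components N q₁ q₂)) (⊕-components (proj₁ y) (proj₂ y) _ _))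

≈-fromComponents : ∀ {x y N} q₁ q₂ → x ≡ (proj₁ y ℤ.+ N ℤ.* q₁ , proj₂ y ℤ.+ N ℤ.* q₂) → x ≈[ N ] y
≈-fromComponents {y = y} {N} q₁ q₂ e =
  (q₁ , q₂) , trans e (sym (trans (cong (y ⊕_) (fromℤ-*-components N q₁ q₂)) (⊕-components (proj₁ y) (proj₂ y) _ _)))

≡[modᴬ]⇒≈ : ∀ {x y N} → x ≡ y [modᴬ N ] → x ≈[ N ] y
≡[modᴬ]⇒≈ {a , b} {c , e} {N} (N∣a-c , N∣b-e) with ℤS.∣ᵤ⇒∣ N∣a-c | ℤS.∣ᵤ⇒∣ N∣b-e
... | ℤS.divides q₁ eq₁ | ℤS.divides q₂ eq₂ =
  ≈-fromComponents q₁ q₂ (pair≡ (shift a c N q₁ eq₁) (shift b e N q₂ eq₂))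
  where
  shift : ∀ a c N q → a ℤ.- c ≡ q ℤ.* N → a ≡ c ℤ.+ N ℤ.* q
  shift a c N q h = trans (split a c) (trans (cong (λ t → c ℤ.+ t) h) (cong (λ t → c ℤ.+ t) (ℤP.*-comm q N)))
    where
    split : ∀ a c → a ≡ c ℤ.+ (a ℤ.- c)
    split = solve-∀

≈⇒≡[modᴬ] : ∀ {x y N} → x ≈[ N ] y → x ≡ y [modᴬ N ]
≈⇒≡[modᴬ] {a , b} {c , e} {N} x≈y with ≈-components x≈y
... | q₁ , q₂ , eq = ℤS.∣⇒∣ᵤ (ℤS.divides q₁ (unshift a c N q₁ (cong proj₁ eq)))
                   , ℤS.∣⇒∣ᵤ (ℤS.divides q₂ (unshift b e N q₂ (cong proj₂ eq)))
  where
  unshift : ∀ a c N q → a ≡ c ℤ.+ N ℤ.* q → a ℤ.- c ≡ q ℤ.* N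
  unshift a c N q refl = cancel c N q
    where
    cancel : ∀ c N q → c ℤ.+ N ℤ.* q ℤ.- c ≡ q ℤ.* N
    cancel = solve-∀

2^ᴬ : ℕ → ZA
2^ᴬ n = fromℤ (two^ n)

two^-+ : ∀ a b → two^ (a ℕ.+ b) ≡ two^ a ℤ.* two^ b
two^-+ a b = trans (cong +_ (ℕP.^-distribˡ-+-* 2 a b)) (ℤP.pos-* (2 ℕ.^ a) (2 ℕ.^ b))

two^-nonZero : ∀ a → ℤ.NonZero (two^ a)
two^-nonZero a = ℕP.m^n≢0 2 a

2^ᴬ-+ : ∀ a b → 2^ᴬ (a ℕ.+ b) ≡ 2^ᴬ a ⊗ 2^ᴬ b
2^ᴬ-+ a b = trans (cong fromℤ (two^-+ a b)) (fromℤ-* (two^ a) (two^ b))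

2^ᴬ-suc : ∀ k → 2^ᴬ (suc k) ≡ fromℤ (+ 2) ⊗ 2^ᴬ k
2^ᴬ-suc k = trans (cong fromℤ (ℤP.pos-* 2 (2 ℕ.^ k))) (fromℤ-* (+ 2) (two^ k))

2^ᴬ-+-assoc : ∀ p q x → 2^ᴬ (p ℕ.+ q) ⊗ x ≡ 2^ᴬ p ⊗ (2^ᴬ q ⊗ x)
2^ᴬ-+-assoc p q x = trans (cong (_⊗ x) (2^ᴬ-+ p q)) (⊗-assoc (2^ᴬ p) (2^ᴬ q) x)

≈-two^-≤ : ∀ {x y} a b → a ℕ.≤ b → x ≈[ two^ b ] y → x ≈[ two^ a ] y
≈-two^-≤ {x} {y} a b a≤b x≈y with ℕP.m≤n⇒∃[o]m+o≡n a≤b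
... | o , refl = ≈-divisor (two^ a) (two^ o) (subst (λ N → x ≈[ N ] y) (two^-+ a o) x≈y)

Coherent : Seq → Set
Coherent x = ∀ n → x (suc n) ≈[ two^ n ] x n

IsO⇒Coherent : ∀ {x} → IsO x → Coherent x
IsO⇒Coherent h n = ≡[modᴬ]⇒≈ (h n)

Coherent⇒IsO : ∀ {x} → Coherent x → IsO x
Coherent⇒IsO h n = ≈⇒≡[modᴬ] (h n)

coherent-+ : ∀ {x} → Coherent x → ∀ n k → x (n ℕ.+ k) ≈[ two^ n ] x n
coherent-+ {x} h n zero = subst (λ t → x t ≈[ two^ n ] x n) (sym (ℕP.+-identityʳ n)) ≈-refl
coherent-+ {x} h n (suc k) = subst (λ t → x t ≈[ two^ n ] x n) (sym (ℕP.+-suc n k))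
  (≈-trans (≈-two^-≤ n (n ℕ.+ k) (ℕP.m≤m+n n k) (h (n ℕ.+ k))) (coherent-+ h n k))

coherent-≤ : ∀ {x} → Coherent x → ∀ n m → n ℕ.≤ m → x m ≈[ two^ n ] x n
coherent-≤ h n m n≤m with ℕP.m≤n⇒∃[o]m+o≡n n≤m
... | k , refl = coherent-+ h n k

cancel-2^ᴬ : ∀ {x y} a → Coherent x → Coherent y → (∀ n → 2^ᴬ a ⊗ x n ≈[ two^ n ] 2^ᴬ a ⊗ y n) →
  ∀ n → x n ≈[ two^ n ] y n
cancel-2^ᴬ {x} {y} a hx hy e n =
  ≈-trans (≈-sym (coherent-+ hx n a))
    (≈-trans (≈-cancelˡ (two^ a) {{two^-nonZero a}}
                (subst (λ N → 2^ᴬ a ⊗ x (n ℕ.+ a) ≈[ N ] 2^ᴬ a ⊗ y (n ℕ.+ a))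
                       (trans (cong two^ (ℕP.+-comm n a)) (two^-+ a n)) (e (n ℕ.+ a))))
             (coherent-+ hy n a))

coherent-const : ∀ c → Coherent (λ _ → c)
coherent-const c n = ≈-refl

coherent-⊕ : ∀ {x y} → Coherent x → Coherent y → Coherent (λ n → x n ⊕ y n)
coherent-⊕ hx hy n = ⊕-cong (hx n) (hy n)

coherent-⊗ : ∀ {x y} → Coherent x → Coherent y → Coherent (λ n → x n ⊗ y n)
coherent-⊗ hx hy n = ⊗-cong (hx n) (hy n)

coherent-neg : ∀ {x} → Coherent x → Coherent (λ n → -ᴬ x n)
coherent-neg h n = -ᴬ-cong (h n)

infixr 8 _^ᴬ_
_^ᴬ_ : ZA → ℕ → ZA
z ^ᴬ zero = 1ᴬ
z ^ᴬ suc k = z ⊗ z ^ᴬ k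

^ᴬ-cong : ∀ {x y N} k → x ≈[ N ] y → x ^ᴬ k ≈[ N ] y ^ᴬ k
^ᴬ-cong zero e = ≈-refl
^ᴬ-cong (suc k) e = ⊗-cong e (^ᴬ-cong k e)

1^ᴬ : ∀ k → 1ᴬ ^ᴬ k ≡ 1ᴬ
1^ᴬ zero = refl
1^ᴬ (suc k) = trans (cong (1ᴬ ⊗_) (1^ᴬ k)) (⊗-identityˡ 1ᴬ)

0^ᴬ-suc : ∀ k → 0ᴬ ^ᴬ suc k ≡ 0ᴬ
0^ᴬ-suc k = ⊗-zeroˡ (0ᴬ ^ᴬ k)

^ᴬ-+ : ∀ x a b → x ^ᴬ (a ℕ.+ b) ≡ x ^ᴬ a ⊗ x ^ᴬ b
^ᴬ-+ x zero b = sym (⊗-identityˡ (x ^ᴬ b))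
^ᴬ-+ x (suc a) b = trans (cong (x ⊗_) (^ᴬ-+ x a b)) (sym (⊗-assoc x (x ^ᴬ a) (x ^ᴬ b)))

^ᴬ-distrib-⊗ : ∀ x y a → (x ⊗ y) ^ᴬ a ≡ x ^ᴬ a ⊗ y ^ᴬ a
^ᴬ-distrib-⊗ x y zero = sym (⊗-identityˡ 1ᴬ)
^ᴬ-distrib-⊗ x y (suc a) = trans (cong (x ⊗ y ⊗_) (^ᴬ-distrib-⊗ x y a)) (interchange x y (x ^ᴬ a) (y ^ᴬ a))
  where
  interchange : ∀ x y a b → x ⊗ y ⊗ (a ⊗ b) ≡ x ⊗ a ⊗ (y ⊗ b)
  interchange = solve 4 (λ x y a b → x :* y :* (a :* b) := x :* a :* (y :* b)) refl

^ᴬ-2* : ∀ x m → x ^ᴬ (2 ℕ.* m) ≡ (x ⊗ x) ^ᴬ m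
^ᴬ-2* x m = trans (^ᴬ-+ x m (m ℕ.+ 0))
  (trans (cong (λ z → x ^ᴬ m ⊗ x ^ᴬ z) (ℕP.+-identityʳ m)) (sym (^ᴬ-distrib-⊗ x x m)))

∑ᴬ : (n : ℕ) → (Fin n → ZA) → ZA
∑ᴬ zero f = 0ᴬ
∑ᴬ (suc n) f = f fzero ⊕ ∑ᴬ n (λ i → f (fsuc i))

∑ᴬ-ext : ∀ n {f g : Fin n → ZA} → (∀ i → f i ≡ g i) → ∑ᴬ n f ≡ ∑ᴬ n g
∑ᴬ-ext zero h = refl
∑ᴬ-ext (suc n) h = cong₂ _⊕_ (h fzero) (∑ᴬ-ext n (λ i → h (fsuc i)))

∑ᴬ-cong : ∀ n {N} {f g : Fin n → ZA} → (∀ i → f i ≈[ N ] g i) → ∑ᴬ n f ≈[ N ] ∑ᴬ n g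
∑ᴬ-cong zero h = ≈-refl
∑ᴬ-cong (suc n) h = ⊕-cong (h fzero) (∑ᴬ-cong n (λ i → h (fsuc i)))

∑ᴬ-⊕ : ∀ n (f g : Fin n → ZA) → ∑ᴬ n (λ i → f i ⊕ g i) ≡ ∑ᴬ n f ⊕ ∑ᴬ n g
∑ᴬ-⊕ zero f g = sym (⊕-identityˡ 0ᴬ)
∑ᴬ-⊕ (suc n) f g = trans (cong (f fzero ⊕ g fzero ⊕_) (∑ᴬ-⊕ n _ _)) (interchange (f fzero) (g fzero) _ _)
  where
  interchange : ∀ a b c d → a ⊕ b ⊕ (c ⊕ d) ≡ a ⊕ c ⊕ (b ⊕ d)
  interchange = solve 4 (λ a b c d → a :+ b :+ (c :+ d) := a :+ c :+ (b :+ d)) refl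

∑ᴬ-⊗ : ∀ n (l : ZA) (f : Fin n → ZA) → ∑ᴬ n (λ i → l ⊗ f i) ≡ l ⊗ ∑ᴬ n f
∑ᴬ-⊗ zero l f = sym (⊗-zeroʳ l)
∑ᴬ-⊗ (suc n) l f = trans (cong (l ⊗ f fzero ⊕_) (∑ᴬ-⊗ n l (λ i → f (fsuc i)))) (factor l (f fzero) _)
  where
  factor : ∀ l a b → l ⊗ a ⊕ l ⊗ b ≡ l ⊗ (a ⊕ b)
  factor = solve 3 (λ l a b → l :* a :+ l :* b := l :* (a :+ b)) refl

∑ᴬ-zero : ∀ n (f : Fin n → ZA) → (∀ i → f i ≡ 0ᴬ) → ∑ᴬ n f ≡ 0ᴬ
∑ᴬ-zero zero f h = refl
∑ᴬ-zero (suc n) f h = trans (cong₂ _⊕_ (h fzero) (∑ᴬ-zero n _ (λ i → h (fsuc i)))) (⊕-identityˡ 0ᴬ)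

∑ᴬ-single : ∀ n (f : Fin n → ZA) j → (∀ i → ¬ (i ≡ j) → f i ≡ 0ᴬ) → ∑ᴬ n f ≡ f j
∑ᴬ-single (suc n) f fzero h =
  trans (cong (f fzero ⊕_) (∑ᴬ-zero n _ (λ i → h (fsuc i) (λ ())))) (⊕-identityʳ (f fzero))
∑ᴬ-single (suc n) f (fsuc j) h =
  trans (cong (_⊕ ∑ᴬ n (λ i → f (fsuc i))) (h fzero (λ ())))
    (trans (⊕-identityˡ _) (∑ᴬ-single n (λ i → f (fsuc i)) j (λ i i≢j → h (fsuc i) (λ e → i≢j (FinP.suc-injective e)))))

∑ᴬ-swap : ∀ n t (F : Fin n → Fin t → ZA) → ∑ᴬ n (λ i → ∑ᴬ t (F i)) ≡ ∑ᴬ t (λ u → ∑ᴬ n (λ i → F i u))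
∑ᴬ-swap n zero F = ∑ᴬ-zero n _ (λ i → refl)
∑ᴬ-swap n (suc t) F =
  trans (∑ᴬ-⊕ n _ _) (cong (∑ᴬ n (λ i → F i fzero) ⊕_) (∑ᴬ-swap n t (λ i u → F i (fsuc u))))

coherent-∑ᴬ : ∀ t (F : Fin t → Seq) → (∀ u → Coherent (F u)) → Coherent (λ n → ∑ᴬ t (λ u → F u n))
coherent-∑ᴬ zero F h = coherent-const 0ᴬ
coherent-∑ᴬ (suc t) F h = coherent-⊕ {F fzero} (h fzero) (coherent-∑ᴬ t (λ u → F (fsuc u)) (λ u → h (fsuc u)))

when : ∀ {A : Set} → Dec A → ZA → ZA
when (yes _) x = x
when (no _) x = 0ᴬ

∑ᴬ-split : ∀ n (f : Fin n → ZA) (j : Fin n) → ∑ᴬ n f ≡ f j ⊕ ∑ᴬ n (λ i → when (¬? (i ≟ j)) (f i))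
∑ᴬ-split n f j =
  trans (∑ᴬ-ext n split)
    (trans (∑ᴬ-⊕ n _ _) (cong (_⊕ ∑ᴬ n (λ i → when (¬? (i ≟ j)) (f i))) (trans (∑ᴬ-single n _ j others) (at-j j))))
  where
  split : ∀ i → f i ≡ when (i ≟ j) (f i) ⊕ when (¬? (i ≟ j)) (f i)
  split i with i ≟ j
  ... | yes _ = sym (⊕-identityʳ (f i))
  ... | no _ = sym (⊕-identityˡ (f i))
  others : ∀ i → ¬ (i ≡ j) → when (i ≟ j) (f i) ≡ 0ᴬ
  others i i≢j with i ≟ j
  ... | yes i≡j = ⊥-elim (i≢j i≡j)
  ... | no _ = refl
  at-j : ∀ j → when (j ≟ j) (f j) ≡ f j
  at-j j with j ≟ j
  ... | yes _ = refl
  ... | no j≢j = ⊥-elim (j≢j refl)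

module Extend {t s : ℕ} (φ : Fin t → Fin s) (φ-injective : Injective _≡_ _≡_ φ) where

  preimage? : ∀ i → Dec (∃ λ u → φ u ≡ i)
  preimage? i = FinP.any? (λ u → φ u ≟ i)

  extendᴬ : ∀ {i} → Dec (∃ λ u → φ u ≡ i) → (Fin t → ZA) → ZA
  extendᴬ (yes (u , _)) H = H u
  extendᴬ (no _) H = 0ᴬ

  ∑ᴬ-extend : (H : Fin t → ZA) → ∑ᴬ s (λ i → extendᴬ (preimage? i) H) ≡ ∑ᴬ t H
  ∑ᴬ-extend H = trans (∑ᴬ-ext s as-sum) (trans (∑ᴬ-swap s t _) (∑ᴬ-ext t column))
    where
    as-sum : ∀ i → extendᴬ (preimage? i) H ≡ ∑ᴬ t (λ u → when (φ u ≟ i) (H u))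
    as-sum i with preimage? i
    ... | yes (u₀ , φu₀≡i) = sym (trans (∑ᴬ-single t _ u₀ others) (at-u₀ (φ u₀ ≟ i)))
      where
      others : ∀ u → ¬ (u ≡ u₀) → when (φ u ≟ i) (H u) ≡ 0ᴬ
      others u u≢u₀ with φ u ≟ i
      ... | yes φu≡i = ⊥-elim (u≢u₀ (φ-injective (trans φu≡i (sym φu₀≡i))))
      ... | no _ = refl
      at-u₀ : ∀ d → when d (H u₀) ≡ H u₀
      at-u₀ (yes _) = refl
      at-u₀ (no φu₀≢i) = ⊥-elim (φu₀≢i φu₀≡i)
    ... | no ∄u = sym (∑ᴬ-zero t _ none)
      where
      none : ∀ u → when (φ u ≟ i) (H u) ≡ 0ᴬ
      none u with φ u ≟ i
      ... | yes φu≡i = ⊥-elim (∄u (u , φu≡i))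
      ... | no _ = refl
    column : ∀ u → ∑ᴬ s (λ i → when (φ u ≟ i) (H u)) ≡ H u
    column u = trans (∑ᴬ-single s _ (φ u) others) (at-φu (φ u ≟ φ u))
      where
      others : ∀ i → ¬ (i ≡ φ u) → when (φ u ≟ i) (H u) ≡ 0ᴬ
      others i i≢φu with φ u ≟ i
      ... | yes φu≡i = ⊥-elim (i≢φu (sym φu≡i))
      ... | no _ = refl
      at-φu : ∀ d → when d (H u) ≡ H u
      at-φu (yes _) = refl
      at-φu (no φu≢φu) = ⊥-elim (φu≢φu refl)

num-+K : ∀ x y n → num (x +K y) n ≡ 2^ᴬ (den y) ⊗ num x n ⊕ 2^ᴬ (den x) ⊗ num y n
num-+K x y n = sym (trans (⊕-def _ _) (cong₂ _+ᴬ_ (⊗-def _ _) (⊗-def _ _)))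

num-*K : ∀ x y n → num (x *K y) n ≡ num x n ⊗ num y n
num-*K x y n = sym (⊗-def _ _)

num-^K : ∀ x d n → num (x ^K d) n ≡ num x n ^ᴬ d
num-^K x zero n = refl
num-^K x (suc d) n = trans (num-*K x (x ^K d) n) (cong (num x n ⊗_) (num-^K x d n))

den-^K : ∀ x d → den (x ^K d) ≡ d ℕ.* den x
den-^K x zero = refl
den-^K x (suc d) = cong (den x ℕ.+_) (den-^K x d)

coherent-num : ∀ x {y} → (∀ n → num x n ≡ y n) → Coherent y → IsK x
coherent-num x {y} e h = Coherent⇒IsO λ n → subst₂ (λ a b → a ≈[ two^ n ] b) (sym (e (suc n))) (sym (e n)) (h n)

isK-*K : ∀ x y → IsK x → IsK y → IsK (x *K y)
isK-*K x y hx hy = coherent-num (x *K y) (num-*K x y) (coherent-⊗ {num x} {num y} (IsO⇒Coherent {num x} hx) (IsO⇒Coherent {num y} hy))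

isK-^K : ∀ x d → IsK x → IsK (x ^K d)
isK-^K x zero hx = Coherent⇒IsO (coherent-const 1ᴬ)
isK-^K x (suc d) hx = isK-*K x (x ^K d) hx (isK-^K x d hx)

isK-+K : ∀ x y → IsK x → IsK y → IsK (x +K y)
isK-+K x y hx hy = coherent-num (x +K y) (num-+K x y)
  (coherent-⊕ (coherent-⊗ (coherent-const (2^ᴬ (den y))) (IsO⇒Coherent {num x} hx))
              (coherent-⊗ (coherent-const (2^ᴬ (den x))) (IsO⇒Coherent {num y} hy)))

isK-sumK : ∀ s (f : Fin s → K) → (∀ i → IsK (f i)) → IsK (sumK s f)
isK-sumK zero f h = Coherent⇒IsO (coherent-const 0ᴬ)
isK-sumK (suc s) f h =
  isK-+K (f fzero) (sumK s (λ i → f (fsuc i))) (h fzero) (isK-sumK s (λ i → f (fsuc i)) (λ i → h (fsuc i)))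

isK-form : ∀ d s a x → (∀ i → IsK (a i)) → (∀ i → IsK (x i)) → IsK (form d s a x)
isK-form d s a x ha hx = isK-sumK s _ (λ i → isK-*K (a i) (x i ^K d) (ha i) (isK-^K (x i) d (hx i)))

sumK-num : ∀ s (f : Fin s → K) (g : Fin s → ZA) E n N →
  (∀ i → 2^ᴬ E ⊗ num (f i) n ≈[ N ] 2^ᴬ (den (f i)) ⊗ g i) →
  2^ᴬ E ⊗ num (sumK s f) n ≈[ N ] 2^ᴬ (den (sumK s f)) ⊗ ∑ᴬ s g
sumK-num zero f g E n N h = ≈-reflexive (trans (⊗-zeroʳ (2^ᴬ E)) (sym (⊗-zeroʳ 1ᴬ)))
sumK-num (suc s) f g E n N h =
  ≈-trans (≈-reflexive (trans (cong (2^ᴬ E ⊗_) (num-+K (f fzero) rest n)) (distribute (2^ᴬ E) (2^ᴬ dr) (2^ᴬ d₀) _ _)))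
    (≈-trans (⊕-cong (⊗-congˡ (2^ᴬ dr) (h fzero))
                     (⊗-congˡ (2^ᴬ d₀) (sumK-num s (λ i → f (fsuc i)) (λ i → g (fsuc i)) E n N (λ i → h (fsuc i)))))
      (≈-reflexive (trans (collect (2^ᴬ d₀) (2^ᴬ dr) (g fzero) _) (cong (_⊗ (g fzero ⊕ ∑ᴬ s (λ i → g (fsuc i)))) (sym (2^ᴬ-+ d₀ dr))))))
  where
  rest : K
  rest = sumK s (λ i → f (fsuc i))
  d₀ : ℕ
  d₀ = den (f fzero)
  dr : ℕ
  dr = den rest
  distribute : ∀ e a b x y → e ⊗ (a ⊗ x ⊕ b ⊗ y) ≡ a ⊗ (e ⊗ x) ⊕ b ⊗ (e ⊗ y)
  distribute = solve 5 (λ e a b x y → e :* (a :* x :+ b :* y) := a :* (e :* x) :+ b :* (e :* y)) refl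
  collect : ∀ a b x y → b ⊗ (a ⊗ x) ⊕ a ⊗ (b ⊗ y) ≡ a ⊗ b ⊗ (x ⊕ y)
  collect = solve 4 (λ a b x y → b :* (a :* x) :+ a :* (b :* y) := a :* b :* (x :+ y)) refl

-- Hensel's lemma for the exponent 2m, m odd

fromℤ-+-ℕ : ∀ a b → fromℤ (+ (a ℕ.+ b)) ≡ fromℤ (+ a) ⊕ fromℤ (+ b)
fromℤ-+-ℕ a b = trans (cong fromℤ (ℤP.pos-+ a b)) (fromℤ-+ (+ a) (+ b))

fromℤ-*-ℕ : ∀ a b → fromℤ (+ (a ℕ.* b)) ≡ fromℤ (+ a) ⊗ fromℤ (+ b)
fromℤ-*-ℕ a b = trans (cong fromℤ (ℤP.pos-* a b)) (fromℤ-* (+ a) (+ b))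

binomial-head : ∀ y h k → Σ ZA λ Q →
  (y ⊕ h) ^ᴬ suc k ≡ y ^ᴬ suc k ⊕ fromℤ (+ suc k) ⊗ h ⊗ y ^ᴬ k ⊕ h ⊗ h ⊗ Q
binomial-head y h zero = 0ᴬ , expand y h
  where
  expand : ∀ y h → (y ⊕ h) ⊗ 1ᴬ ≡ y ⊗ 1ᴬ ⊕ 1ᴬ ⊗ h ⊗ 1ᴬ ⊕ h ⊗ h ⊗ 0ᴬ
  expand = solve 2 (λ y h → (y :+ h) :* con (+ 1)
                          := y :* con (+ 1) :+ con (+ 1) :* h :* con (+ 1) :+ h :* h :* con (+ 0)) refl
binomial-head y h (suc k) with binomial-head y h k
... | Q , e = (y ⊗ Q ⊕ c ⊗ y ^ᴬ k ⊕ h ⊗ Q) ,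
  trans (cong ((y ⊕ h) ⊗_) e)
    (trans (expand y h c (y ^ᴬ k) Q)
      (cong (λ t → y ⊗ (y ⊗ y ^ᴬ k) ⊕ t ⊗ h ⊗ (y ⊗ y ^ᴬ k) ⊕ h ⊗ h ⊗ (y ⊗ Q ⊕ c ⊗ y ^ᴬ k ⊕ h ⊗ Q))
            (sym (fromℤ-+-ℕ 1 (suc k)))))
  where
  c = fromℤ (+ suc k)
  expand : ∀ y h c Y Q → (y ⊕ h) ⊗ (y ⊗ Y ⊕ c ⊗ h ⊗ Y ⊕ h ⊗ h ⊗ Q)
                       ≡ y ⊗ (y ⊗ Y) ⊕ (1ᴬ ⊕ c) ⊗ h ⊗ (y ⊗ Y) ⊕ h ⊗ h ⊗ (y ⊗ Q ⊕ c ⊗ Y ⊕ h ⊗ Q)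
  expand = solve 5 (λ y h c Y Q → (y :+ h) :* (y :* Y :+ c :* h :* Y :+ h :* h :* Q)
    := y :* (y :* Y) :+ (con (+ 1) :+ c) :* h :* (y :* Y) :+ h :* h :* (y :* Q :+ c :* Y :+ h :* Q)) refl

module Hensel (m' : ℕ) (m-odd : fromℤ (+ suc m') ≈[ + 2 ] 1ᴬ) (T : Seq) (T-coherent : Coherent T)
              (r₀ : ZA) (r₀-odd : r₀ ≈[ + 2 ] 1ᴬ) (r₀-root : r₀ ^ᴬ (2 ℕ.* suc m') ≈[ + 8 ] T 3) where

  private
    m : ℕ
    m = suc m'
    d : ℕ
    d = 2 ℕ.* m
    k : ℕ
    k = ℕ.pred d
    two : ZA
    two = fromℤ (+ 2)

  Approximation : ℕ → ZA → Set
  Approximation n y = (y ≈[ + 2 ] 1ᴬ) × (y ^ᴬ d ≈[ two^ (3 ℕ.+ n) ] T (3 ℕ.+ n))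

  -- The derivative d y^(d-1) of y^d has valuation exactly 1, since 1 + m y^(d-1) is even.
  half-derivative : ∀ y → y ≈[ + 2 ] 1ᴬ → Σ ZA λ W → 1ᴬ ⊕ fromℤ (+ m) ⊗ y ^ᴬ k ≡ two ⊗ W
  half-derivative y y-odd
    with ≈-trans (⊕-cong (≈-refl {1ᴬ}) (⊗-cong m-odd (≈-trans (^ᴬ-cong k y-odd) (≈-reflexive (1^ᴬ k)))))
                 (1ᴬ , two-is-even)
    where
    two-is-even : 1ᴬ ⊕ 1ᴬ ⊗ 1ᴬ ≡ 0ᴬ ⊕ fromℤ (+ 2) ⊗ 1ᴬ
    two-is-even = solve 0 (con (+ 1) :+ con (+ 1) :* con (+ 1) := con (+ 0) :+ con (+ 2) :* con (+ 1)) refl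
  ... | (W , eq) = W , trans eq (⊕-identityˡ (two ⊗ W))

  -- Newton step: with y^d = T(4+n) + 2^(3+n) R, the correction y + 2^(2+n) R kills the error modulo 2^(4+n).
  refine : ∀ n → Σ ZA (Approximation n) → Σ ZA (Approximation (suc n))
  refine n (y , y-odd , y-root) with ≈-trans y-root (≈-sym (T-coherent (3 ℕ.+ n)))
  ... | (R , eR) = (y ⊕ h) , ≈-trans (≈-two^-≤ 1 (2 ℕ.+ n) (ℕ.s≤s ℕ.z≤n) (R , refl)) y-odd
                           , ((R ⊗ W ⊕ 2^ᴬ n ⊗ R ⊗ R ⊗ Q) , expansion)
    where
    h = 2^ᴬ (2 ℕ.+ n) ⊗ R
    Q : ZA
    Q = proj₁ (binomial-head y h k)
    W : ZA
    W = proj₁ (half-derivative y y-odd)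
    M : ZA
    M = fromℤ (+ m)
    N : ZA
    N = 2^ᴬ n
    2²N : 2^ᴬ (2 ℕ.+ n) ≡ two ⊗ (two ⊗ N)
    2²N = trans (2^ᴬ-suc (suc n)) (cong (two ⊗_) (2^ᴬ-suc n))
    2³N : 2^ᴬ (3 ℕ.+ n) ≡ two ⊗ (two ⊗ (two ⊗ N))
    2³N = trans (2^ᴬ-suc (2 ℕ.+ n)) (cong (two ⊗_) 2²N)
    2⁴N : 2^ᴬ (4 ℕ.+ n) ≡ two ⊗ (two ⊗ (two ⊗ (two ⊗ N)))
    2⁴N = trans (2^ᴬ-suc (3 ℕ.+ n)) (cong (two ⊗_) 2³N)
    collect : ∀ t N R M yk W Q T₄ → 1ᴬ ⊕ M ⊗ yk ≡ t ⊗ W →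
      T₄ ⊕ t ⊗ (t ⊗ (t ⊗ N)) ⊗ R ⊕ t ⊗ M ⊗ (t ⊗ (t ⊗ N) ⊗ R) ⊗ yk ⊕ (t ⊗ (t ⊗ N) ⊗ R) ⊗ (t ⊗ (t ⊗ N) ⊗ R) ⊗ Q
      ≡ T₄ ⊕ t ⊗ (t ⊗ (t ⊗ (t ⊗ N))) ⊗ (R ⊗ W ⊕ N ⊗ R ⊗ R ⊗ Q)
    collect t N R M yk W Q T₄ eW =
      trans (factor t N R M yk Q T₄)
        (trans (cong (λ u → T₄ ⊕ t ⊗ (t ⊗ (t ⊗ N)) ⊗ R ⊗ u ⊕ t ⊗ t ⊗ t ⊗ t ⊗ N ⊗ N ⊗ R ⊗ R ⊗ Q) eW)
               (absorb t N R W Q T₄))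
      where
      factor : ∀ t N R M yk Q T₄ →
        T₄ ⊕ t ⊗ (t ⊗ (t ⊗ N)) ⊗ R ⊕ t ⊗ M ⊗ (t ⊗ (t ⊗ N) ⊗ R) ⊗ yk ⊕ (t ⊗ (t ⊗ N) ⊗ R) ⊗ (t ⊗ (t ⊗ N) ⊗ R) ⊗ Q
        ≡ T₄ ⊕ t ⊗ (t ⊗ (t ⊗ N)) ⊗ R ⊗ (1ᴬ ⊕ M ⊗ yk) ⊕ t ⊗ t ⊗ t ⊗ t ⊗ N ⊗ N ⊗ R ⊗ R ⊗ Q
      factor = solve 7 (λ t N R M yk Q T₄ →
        T₄ :+ t :* (t :* (t :* N)) :* R :+ t :* M :* (t :* (t :* N) :* R) :* yk
           :+ (t :* (t :* N) :* R) :* (t :* (t :* N) :* R) :* Q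
        := T₄ :+ t :* (t :* (t :* N)) :* R :* (con (+ 1) :+ M :* yk) :+ t :* t :* t :* t :* N :* N :* R :* R :* Q) refl
      absorb : ∀ t N R W Q T₄ →
        T₄ ⊕ t ⊗ (t ⊗ (t ⊗ N)) ⊗ R ⊗ (t ⊗ W) ⊕ t ⊗ t ⊗ t ⊗ t ⊗ N ⊗ N ⊗ R ⊗ R ⊗ Q
        ≡ T₄ ⊕ t ⊗ (t ⊗ (t ⊗ (t ⊗ N))) ⊗ (R ⊗ W ⊕ N ⊗ R ⊗ R ⊗ Q)
      absorb = solve 6 (λ t N R W Q T₄ →
        T₄ :+ t :* (t :* (t :* N)) :* R :* (t :* W) :+ t :* t :* t :* t :* N :* N :* R :* R :* Q
        := T₄ :+ t :* (t :* (t :* (t :* N))) :* (R :* W :+ N :* R :* R :* Q)) refl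
    expansion : (y ⊕ h) ^ᴬ d ≡ T (4 ℕ.+ n) ⊕ 2^ᴬ (4 ℕ.+ n) ⊗ (R ⊗ W ⊕ 2^ᴬ n ⊗ R ⊗ R ⊗ Q)
    expansion = begin
      (y ⊕ h) ^ᴬ d
        ≡⟨ proj₂ (binomial-head y h k) ⟩
      y ^ᴬ d ⊕ fromℤ (+ d) ⊗ h ⊗ y ^ᴬ k ⊕ h ⊗ h ⊗ Q
        ≡⟨ cong₂ (λ u v → u ⊕ v ⊗ h ⊗ y ^ᴬ k ⊕ h ⊗ h ⊗ Q) eR (fromℤ-*-ℕ 2 m) ⟩
      T (4 ℕ.+ n) ⊕ 2^ᴬ (3 ℕ.+ n) ⊗ R ⊕ two ⊗ M ⊗ h ⊗ y ^ᴬ k ⊕ h ⊗ h ⊗ Q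
        ≡⟨ cong₂ (λ u v → T (4 ℕ.+ n) ⊕ u ⊗ R ⊕ two ⊗ M ⊗ (v ⊗ R) ⊗ y ^ᴬ k ⊕ (v ⊗ R) ⊗ (v ⊗ R) ⊗ Q) 2³N 2²N ⟩
      _ ≡⟨ collect two N R M (y ^ᴬ k) W Q (T (4 ℕ.+ n)) (proj₂ (half-derivative y y-odd)) ⟩
      T (4 ℕ.+ n) ⊕ two ⊗ (two ⊗ (two ⊗ (two ⊗ N))) ⊗ (R ⊗ W ⊕ N ⊗ R ⊗ R ⊗ Q)
        ≡⟨ cong (λ u → T (4 ℕ.+ n) ⊕ u ⊗ (R ⊗ W ⊕ N ⊗ R ⊗ R ⊗ Q)) (sym 2⁴N) ⟩
      T (4 ℕ.+ n) ⊕ 2^ᴬ (4 ℕ.+ n) ⊗ (R ⊗ W ⊕ 2^ᴬ n ⊗ R ⊗ R ⊗ Q) ∎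
      where open ≡-Reasoning

  approximation : ∀ n → Σ ZA (Approximation n)
  approximation zero = r₀ , r₀-odd , r₀-root
  approximation (suc n) = refine n (approximation n)

  root : Seq
  root n = proj₁ (approximation n)

  refine-close : ∀ n p → proj₁ (refine n p) ≈[ two^ (2 ℕ.+ n) ] proj₁ p
  refine-close n (y , y-odd , y-root) with ≈-trans y-root (≈-sym (T-coherent (3 ℕ.+ n)))
  ... | (R , eR) = R , refl

  root-coherent : Coherent root
  root-coherent n = ≈-two^-≤ n (2 ℕ.+ n) (ℕP.m≤n+m n 2) (refine-close n (approximation n))

  root-odd : ∀ n → root n ≈[ + 2 ] 1ᴬ
  root-odd n = proj₁ (proj₂ (approximation n))

  root-^ : ∀ n → root n ^ᴬ d ≈[ two^ n ] T n
  root-^ n = ≈-trans (≈-two^-≤ n (3 ℕ.+ n) (ℕP.m≤n+m n 3) (proj₂ (proj₂ (approximation n))))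
                     (subst (λ u → T u ≈[ two^ n ] T n) (ℕP.+-comm n 3) (coherent-+ T-coherent n 3))

-- Residues modulo 8

data Pair3 : Set where
  AB AC BC : Pair3

_==_ : Bool → Bool → Bool
true == true = true
false == false = true
_ == _ = false

==-true : ∀ {x y} → (x == y) ≡ true → x ≡ y
==-true {true} {true} _ = refl
==-true {false} {false} _ = refl

equalPair : Bool → Bool → Bool → Pair3
equalPair x y z with x == y | x == z
... | true | _ = AB
... | false | true = AC
... | false | false = BC

pairFst pairSnd pairRest : Pair3 → {A : Set} → A → A → A → A
pairFst AB x y z = x
pairFst AC x y z = x
pairFst BC x y z = y
pairSnd AB x y z = y
pairSnd AC x y z = z
pairSnd BC x y z = z
pairRest AB x y z = z
pairRest AC x y z = y
pairRest BC x y z = x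

equalPair-equal : ∀ x y z → let p = equalPair x y z in pairFst p x y z ≡ pairSnd p x y z
equalPair-equal true true z = refl
equalPair-equal false false z = refl
equalPair-equal true false true = refl
equalPair-equal false true false = refl
equalPair-equal true false false = refl
equalPair-equal false true true = refl

pairFst-natural : ∀ p {A B : Set} (f : A → B) x y z → f (pairFst p x y z) ≡ pairFst p (f x) (f y) (f z)
pairFst-natural AB f x y z = refl
pairFst-natural AC f x y z = refl
pairFst-natural BC f x y z = refl

pairSnd-natural : ∀ p {A B : Set} (f : A → B) x y z → f (pairSnd p x y z) ≡ pairSnd p (f x) (f y) (f z)
pairSnd-natural AB f x y z = refl
pairSnd-natural AC f x y z = refl
pairSnd-natural BC f x y z = refl

colourPair : ∀ {A : Set} (c : A → Bool) x y z → let p = equalPair (c x) (c y) (c z) in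
  c (pairFst p x y z) ≡ c (pairSnd p x y z)
colourPair c x y z = let p = equalPair (c x) (c y) (c z) in
  trans (pairFst-natural p c x y z) (trans (equalPair-equal (c x) (c y) (c z)) (sym (pairSnd-natural p c x y z)))

#0 #1 #2 #3 #4 #5 : Fin 6
#0 = fzero
#1 = fsuc fzero
#2 = fsuc (fsuc fzero)
#3 = fsuc (fsuc (fsuc fzero))
#4 = fsuc (fsuc (fsuc (fsuc fzero)))
#5 = fsuc (fsuc (fsuc (fsuc (fsuc fzero))))

-- Positions 0,1 and 2,3 receive a pair found among three candidates; 4,5 receive the leftovers.
pairing : Pair3 → Pair3 → Fin 6 → Fin 6
pairing p q fzero = pairFst p #0 #1 #2
pairing p q (fsuc fzero) = pairSnd p #0 #1 #2
pairing p q (fsuc (fsuc fzero)) = pairFst q (pairRest p #0 #1 #2) #3 #4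
pairing p q (fsuc (fsuc (fsuc fzero))) = pairSnd q (pairRest p #0 #1 #2) #3 #4
pairing p q (fsuc (fsuc (fsuc (fsuc fzero)))) = pairRest q (pairRest p #0 #1 #2) #3 #4
pairing p q (fsuc (fsuc (fsuc (fsuc (fsuc fzero))))) = #5

injective? : (f : Fin 6 → Fin 6) → Dec (∀ x y → f x ≡ f y → x ≡ y)
injective? f = FinP.all? (λ x → FinP.all? (λ y → (f x ≟ f y) →-dec (x ≟ y)))

pairing-injective : ∀ p q → Injective _≡_ _≡_ (pairing p q)
pairing-injective p q = injective (by-enumeration p q)
  where
  injective : ∀ {f} → True (injective? f) → Injective _≡_ _≡_ f
  injective t {x} {y} = toWitness t x y
  by-enumeration : ∀ p q → True (injective? (pairing p q))
  by-enumeration AB AB = tt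
  by-enumeration AB AC = tt
  by-enumeration AB BC = tt
  by-enumeration AC AB = tt
  by-enumeration AC AC = tt
  by-enumeration AC BC = tt
  by-enumeration BC AB = tt
  by-enumeration BC AC = tt
  by-enumeration BC BC = tt

record Pairing (c : Fin 6 → Bool) : Set where
  field
    π : Fin 6 → Fin 6
    π-injective : Injective _≡_ _≡_ π
    pair₀₁ : c (π #0) ≡ c (π #1)
    pair₂₃ : c (π #2) ≡ c (π #3)

pairUp : (c : Fin 6 → Bool) → Pairing c
pairUp c = record
  { π = pairing p q ; π-injective = pairing-injective p q
  ; pair₀₁ = colourPair c #0 #1 #2 ; pair₂₃ = colourPair c r #3 #4 }
  where
  p : Pair3
  p = equalPair (c #0) (c #1) (c #2)
  r : Fin 6
  r = pairRest p #0 #1 #2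
  q : Pair3
  q = equalPair (c r) (c #3) (c #4)

bit : Bool → ℤ
bit true = + 1
bit false = + 0

bitᴬ : Bool → ZA
bitᴬ b = fromℤ (bit b)

bitᴬ-∧ : ∀ a b → bitᴬ (a ∧ b) ≡ bitᴬ a ⊗ bitᴬ b
bitᴬ-∧ false b = sym (⊗-zeroˡ (bitᴬ b))
bitᴬ-∧ true b = sym (⊗-identityˡ (bitᴬ b))

opaque
  parity : ∀ x → Σ Bool λ r → Σ ℤ λ q → x ≡ bit r ℤ.+ + 2 ℤ.* q
  parity x with x ℤDM.%ℕ 2 | ℤDM.n%ℕd<d x 2 | ℤDM.a≡a%ℕn+[a/ℕn]*n x 2
  ... | 0 | _ | eq = false , x ℤDM./ℕ 2 , trans eq (cong (λ u → + 0 ℤ.+ u) (ℤP.*-comm (x ℤDM./ℕ 2) (+ 2)))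
  ... | 1 | _ | eq = true , x ℤDM./ℕ 2 , trans eq (cong (λ u → + 1 ℤ.+ u) (ℤP.*-comm (x ℤDM./ℕ 2) (+ 2)))
  ... | suc (suc _) | ℕ.s≤s (ℕ.s≤s ()) | _

two*≢one : ∀ z → ¬ (+ 2 ℤ.* z ≡ + 1)
two*≢one z eq with ℕP.m*n≡1⇒m≡1 2 ℤ.∣ z ∣ (trans (sym (ℤP.abs-* (+ 2) z)) (cong ℤ.∣_∣ eq))
... | ()

odd≢even : ∀ x y → ¬ (+ 1 ℤ.+ + 2 ℤ.* x ≡ + 2 ℤ.* y)
odd≢even x y eq = two*≢one (y ℤ.- x) (trans (distrib y x) (trans (cong (ℤ._- + 2 ℤ.* x) (sym eq)) (cancel x)))
  where
  distrib : ∀ y x → + 2 ℤ.* (y ℤ.- x) ≡ + 2 ℤ.* y ℤ.- + 2 ℤ.* x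
  distrib = solve-∀
  cancel : ∀ x → + 1 ℤ.+ + 2 ℤ.* x ℤ.- + 2 ℤ.* x ≡ + 1
  cancel = solve-∀

1≉0 : ¬ (1ᴬ ≈[ + 2 ] 0ᴬ)
1≉0 h with ≈-components h
... | q₁ , q₂ , e = two*≢one q₁ (sym (trans (cong proj₁ e) (ℤP.+-identityˡ (+ 2 ℤ.* q₁))))

record Multiple (N₁ N₂ : ℤ) (X : ZA) : Set where
  constructor multiple
  field
    a b : ℤ
    equation : X ≡ (N₁ ℤ.* a , N₂ ℤ.* b)

Multiple-8⇒≈0 : ∀ {X} → Multiple (+ 8) (+ 8) X → X ≈[ + 8 ] 0ᴬ
Multiple-8⇒≈0 (multiple a b e) = ≈-fromComponents a b (trans e (sym (pair≡ (ℤP.+-identityˡ _) (ℤP.+-identityˡ _))))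

record Odd (t : ZA) : Set where
  constructor odd
  field
    a : ℤ
    colour : Bool
    b : ℤ
    equation : t ≡ (+ 1 ℤ.+ + 2 ℤ.* a , + 2 ℤ.* bit colour ℤ.+ + 4 ℤ.* b)

opaque
  odd-decompose : ∀ {t} → t ≈[ + 2 ] 1ᴬ → Odd t
  odd-decompose h with ≈-components h
  ... | q₁ , q₂ , e with parity q₂
  ... | c , b , e₂ = odd q₁ c b (trans e (pair≡ refl (trans (cong (λ u → + 0 ℤ.+ + 2 ℤ.* u) e₂) (expand (bit c) b))))
    where
    expand : ∀ c b → + 0 ℤ.+ + 2 ℤ.* (c ℤ.+ + 2 ℤ.* b) ≡ + 2 ℤ.* c ℤ.+ + 4 ℤ.* b
    expand = solve-∀

data UnitShape (w : ZA) : Set where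
  α-odd : ∀ P Q → w ≡ (P , + 1 ℤ.+ + 2 ℤ.* Q) → UnitShape w
  α-even : ∀ P Q → w ≡ (+ 1 ℤ.+ + 2 ℤ.* P , + 2 ℤ.* Q) → UnitShape w

opaque
  unitShape : ∀ w → ¬ (w ≈[ + 2 ] 0ᴬ) → UnitShape w
  unitShape (P , Q) w≉0 with parity Q
  ... | true , Q' , eQ = α-odd P Q' (pair≡ refl eQ)
  ... | false , Q' , eQ with parity P
  ... | true , P' , eP = α-even P' Q' (pair≡ eP (trans eQ (ℤP.+-identityˡ _)))
  ... | false , P' , eP = ⊥-elim (w≉0 (≈-fromComponents P' Q' (pair≡ eP eQ)))

opaque
  sameColour-pair : ∀ {t t'} (o : Odd t) (o' : Odd t') → Odd.colour o ≡ Odd.colour o' →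
    Multiple (+ 2) (+ 4) (t ⊕ t')
  sameColour-pair (odd a c b eq) (odd a' .c b' eq') refl =
    multiple (+ 1 ℤ.+ a ℤ.+ a') (bit c ℤ.+ b ℤ.+ b')
      (trans (cong₂ _⊕_ eq eq') (trans (⊕-components _ _ _ _) (pair≡ (fst a a') (snd (bit c) b b'))))
    where
    fst : ∀ a a' → + 1 ℤ.+ + 2 ℤ.* a ℤ.+ (+ 1 ℤ.+ + 2 ℤ.* a') ≡ + 2 ℤ.* (+ 1 ℤ.+ a ℤ.+ a')
    fst = solve-∀
    snd : ∀ c b b' → + 2 ℤ.* c ℤ.+ + 4 ℤ.* b ℤ.+ (+ 2 ℤ.* c ℤ.+ + 4 ℤ.* b') ≡ + 4 ℤ.* (c ℤ.+ b ℤ.+ b')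
    snd = solve-∀

opaque
  differentColour-pair : ∀ {t t' w} (o : Odd t) (o' : Odd t') → (Odd.colour o == Odd.colour o') ≡ false →
    ∀ P Q → w ≡ (P , + 1 ℤ.+ + 2 ℤ.* Q) → Multiple (+ 2) (+ 4) (t ⊕ t' ⊕ fromℤ (+ 2) ⊗ w)
  differentColour-pair (odd a c b eq) (odd a' c' b' eq') c≠c' P Q refl =
    multiple (+ 1 ℤ.+ a ℤ.+ a' ℤ.+ P) (+ 1 ℤ.+ b ℤ.+ b' ℤ.+ Q)
      (trans (cong (_⊕ fromℤ (+ 2) ⊗ (P , + 1 ℤ.+ + 2 ℤ.* Q)) (trans (cong₂ _⊕_ eq eq') (⊕-components _ _ _ _)))
      (trans (cong (_ ⊕_) (fromℤ-*-components (+ 2) P _))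
      (trans (⊕-components _ _ _ _) (pair≡ (fst a a' P) (snd c c' c≠c')))))
    where
    fst : ∀ a a' P → + 1 ℤ.+ + 2 ℤ.* a ℤ.+ (+ 1 ℤ.+ + 2 ℤ.* a') ℤ.+ + 2 ℤ.* P ≡ + 2 ℤ.* (+ 1 ℤ.+ a ℤ.+ a' ℤ.+ P)
    fst = solve-∀
    snd-tf : ∀ b b' Q → + 2 ℤ.* + 1 ℤ.+ + 4 ℤ.* b ℤ.+ (+ 2 ℤ.* + 0 ℤ.+ + 4 ℤ.* b') ℤ.+ + 2 ℤ.* (+ 1 ℤ.+ + 2 ℤ.* Q)
                     ≡ + 4 ℤ.* (+ 1 ℤ.+ b ℤ.+ b' ℤ.+ Q)
    snd-tf = solve-∀
    snd-ft : ∀ b b' Q → + 2 ℤ.* + 0 ℤ.+ + 4 ℤ.* b ℤ.+ (+ 2 ℤ.* + 1 ℤ.+ + 4 ℤ.* b') ℤ.+ + 2 ℤ.* (+ 1 ℤ.+ + 2 ℤ.* Q)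
                     ≡ + 4 ℤ.* (+ 1 ℤ.+ b ℤ.+ b' ℤ.+ Q)
    snd-ft = solve-∀
    snd : ∀ c c' → (c == c') ≡ false →
      + 2 ℤ.* bit c ℤ.+ + 4 ℤ.* b ℤ.+ (+ 2 ℤ.* bit c' ℤ.+ + 4 ℤ.* b') ℤ.+ + 2 ℤ.* (+ 1 ℤ.+ + 2 ℤ.* Q)
      ≡ + 4 ℤ.* (+ 1 ℤ.+ b ℤ.+ b' ℤ.+ Q)
    snd true false _ = snd-tf b b' Q
    snd false true _ = snd-ft b b' Q

opaque
  twice-α-even : ∀ {w} P Q → w ≡ (+ 1 ℤ.+ + 2 ℤ.* P , + 2 ℤ.* Q) → Multiple (+ 2) (+ 4) (fromℤ (+ 2) ⊗ w)
  twice-α-even P Q refl =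
    multiple (+ 1 ℤ.+ + 2 ℤ.* P) Q (trans (fromℤ-*-components (+ 2) _ _) (pair≡ refl (sym (ℤP.*-assoc (+ 2) (+ 2) Q))))

  twice-α-even-not-4 : ∀ {w} P Q → w ≡ (+ 1 ℤ.+ + 2 ℤ.* P , + 2 ℤ.* Q) → ¬ Multiple (+ 4) (+ 8) (fromℤ (+ 2) ⊗ w)
  twice-α-even-not-4 P Q refl (multiple a b eq) =
    odd≢even P a (ℤP.*-cancelˡ-≡ (+ 2) _ _
      (trans (cong proj₁ (trans (sym (fromℤ-*-components (+ 2) _ _)) eq)) (ℤP.*-assoc (+ 2) (+ 2) a)))

-- Any three vectors (rᵢ, sᵢ) of 𝔽₂² satisfy a nontrivial relation ∑ fᵢ (rᵢ, sᵢ) = 0.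
record Relation (r₁ r₂ r₃ s₁ s₂ s₃ : Bool) : Set where
  constructor relation
  field
    f₁ f₂ f₃ : Bool
    k k' : ℤ
    r-even : bit f₁ ℤ.* bit r₁ ℤ.+ bit f₂ ℤ.* bit r₂ ℤ.+ bit f₃ ℤ.* bit r₃ ≡ + 2 ℤ.* k
    s-even : bit f₁ ℤ.* bit s₁ ℤ.+ bit f₂ ℤ.* bit s₂ ℤ.+ bit f₃ ℤ.* bit s₃ ≡ + 2 ℤ.* k'
    nontrivial : f₁ ∨ (f₂ ∨ f₃) ≡ true

F₂²-relation : ∀ r₁ r₂ r₃ s₁ s₂ s₃ → Relation r₁ r₂ r₃ s₁ s₂ s₃
F₂²-relation false false false false false false = relation true false false (+ 0) (+ 0) refl refl refl
F₂²-relation false false false false false true = relation true false false (+ 0) (+ 0) refl refl refl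
F₂²-relation false false false false true false = relation true false false (+ 0) (+ 0) refl refl refl
F₂²-relation false false false false true true = relation true false false (+ 0) (+ 0) refl refl refl
F₂²-relation false false false true false false = relation false true false (+ 0) (+ 0) refl refl refl
F₂²-relation false false false true false true = relation false true false (+ 0) (+ 0) refl refl refl
F₂²-relation false false false true true false = relation false false true (+ 0) (+ 0) refl refl refl
F₂²-relation false false false true true true = relation true true false (+ 0) (+ 1) refl refl refl
F₂²-relation false false true false false false = relation true false false (+ 0) (+ 0) refl refl refl
F₂²-relation false false true false false true = relation true false false (+ 0) (+ 0) refl refl refl
F₂²-relation false false true false true false = relation true false false (+ 0) (+ 0) refl refl refl
F₂²-relation false false true false true true = relation true false false (+ 0) (+ 0) refl refl refl
F₂²-relation false false true true false false = relation false true false (+ 0) (+ 0) refl refl refl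
F₂²-relation false false true true false true = relation false true false (+ 0) (+ 0) refl refl refl
F₂²-relation false false true true true false = relation true true false (+ 0) (+ 1) refl refl refl
F₂²-relation false false true true true true = relation true true false (+ 0) (+ 1) refl refl refl
F₂²-relation false true false false false false = relation true false false (+ 0) (+ 0) refl refl refl
F₂²-relation false true false false false true = relation true false false (+ 0) (+ 0) refl refl refl
F₂²-relation false true false false true false = relation true false false (+ 0) (+ 0) refl refl refl
F₂²-relation false true false false true true = relation true false false (+ 0) (+ 0) refl refl refl
F₂²-relation false true false true false false = relation false false true (+ 0) (+ 0) refl refl refl
F₂²-relation false true false true false true = relation true false true (+ 0) (+ 1) refl refl refl
F₂²-relation false true false true true false = relation false false true (+ 0) (+ 0) refl refl refl
F₂²-relation false true false true true true = relation true false true (+ 0) (+ 1) refl refl refl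
F₂²-relation false true true false false false = relation true false false (+ 0) (+ 0) refl refl refl
F₂²-relation false true true false false true = relation true false false (+ 0) (+ 0) refl refl refl
F₂²-relation false true true false true false = relation true false false (+ 0) (+ 0) refl refl refl
F₂²-relation false true true false true true = relation true false false (+ 0) (+ 0) refl refl refl
F₂²-relation false true true true false false = relation false true true (+ 1) (+ 0) refl refl refl
F₂²-relation false true true true false true = relation true true true (+ 1) (+ 1) refl refl refl
F₂²-relation false true true true true false = relation true true true (+ 1) (+ 1) refl refl refl
F₂²-relation false true true true true true = relation false true true (+ 1) (+ 1) refl refl refl
F₂²-relation true false false false false false = relation false true false (+ 0) (+ 0) refl refl refl
F₂²-relation true false false false false true = relation false true false (+ 0) (+ 0) refl refl refl
F₂²-relation true false false false true false = relation false false true (+ 0) (+ 0) refl refl refl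
F₂²-relation true false false false true true = relation false true true (+ 0) (+ 1) refl refl refl
F₂²-relation true false false true false false = relation false true false (+ 0) (+ 0) refl refl refl
F₂²-relation true false false true false true = relation false true false (+ 0) (+ 0) refl refl refl
F₂²-relation true false false true true false = relation false false true (+ 0) (+ 0) refl refl refl
F₂²-relation true false false true true true = relation false true true (+ 0) (+ 1) refl refl refl
F₂²-relation true false true false false false = relation false true false (+ 0) (+ 0) refl refl refl
F₂²-relation true false true false false true = relation false true false (+ 0) (+ 0) refl refl refl
F₂²-relation true false true false true false = relation true false true (+ 1) (+ 0) refl refl refl
F₂²-relation true false true false true true = relation true true true (+ 1) (+ 1) refl refl refl
F₂²-relation true false true true false false = relation false true false (+ 0) (+ 0) refl refl refl
F₂²-relation true false true true false true = relation false true false (+ 0) (+ 0) refl refl refl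
F₂²-relation true false true true true false = relation true true true (+ 1) (+ 1) refl refl refl
F₂²-relation true false true true true true = relation true false true (+ 1) (+ 1) refl refl refl
F₂²-relation true true false false false false = relation false false true (+ 0) (+ 0) refl refl refl
F₂²-relation true true false false false true = relation true true false (+ 1) (+ 0) refl refl refl
F₂²-relation true true false false true false = relation false false true (+ 0) (+ 0) refl refl refl
F₂²-relation true true false false true true = relation true true true (+ 1) (+ 1) refl refl refl
F₂²-relation true true false true false false = relation false false true (+ 0) (+ 0) refl refl refl
F₂²-relation true true false true false true = relation true true true (+ 1) (+ 1) refl refl refl
F₂²-relation true true false true true false = relation false false true (+ 0) (+ 0) refl refl refl
F₂²-relation true true false true true true = relation true true false (+ 1) (+ 1) refl refl refl
F₂²-relation true true true false false false = relation true true false (+ 1) (+ 0) refl refl refl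
F₂²-relation true true true false false true = relation true true false (+ 1) (+ 0) refl refl refl
F₂²-relation true true true false true false = relation true false true (+ 1) (+ 0) refl refl refl
F₂²-relation true true true false true true = relation false true true (+ 1) (+ 1) refl refl refl
F₂²-relation true true true true false false = relation false true true (+ 1) (+ 0) refl refl refl
F₂²-relation true true true true false true = relation true false true (+ 1) (+ 1) refl refl refl
F₂²-relation true true true true true false = relation true true false (+ 1) (+ 1) refl refl refl
F₂²-relation true true true true true true = relation true true false (+ 1) (+ 1) refl refl refl

opaque
  scale-relation : ∀ N f₁ f₂ f₃ r₁ r₂ r₃ u₁ u₂ u₃ k → f₁ ℤ.* r₁ ℤ.+ f₂ ℤ.* r₂ ℤ.+ f₃ ℤ.* r₃ ≡ + 2 ℤ.* k →
    f₁ ℤ.* (N ℤ.* (r₁ ℤ.+ + 2 ℤ.* u₁)) ℤ.+ f₂ ℤ.* (N ℤ.* (r₂ ℤ.+ + 2 ℤ.* u₂)) ℤ.+ f₃ ℤ.* (N ℤ.* (r₃ ℤ.+ + 2 ℤ.* u₃))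
    ≡ (N ℤ.* + 2) ℤ.* (k ℤ.+ (f₁ ℤ.* u₁ ℤ.+ f₂ ℤ.* u₂ ℤ.+ f₃ ℤ.* u₃))
  scale-relation N f₁ f₂ f₃ r₁ r₂ r₃ u₁ u₂ u₃ k h =
    trans (split N f₁ f₂ f₃ r₁ r₂ r₃ u₁ u₂ u₃)
      (trans (cong (λ z → N ℤ.* z ℤ.+ N ℤ.* + 2 ℤ.* (f₁ ℤ.* u₁ ℤ.+ f₂ ℤ.* u₂ ℤ.+ f₃ ℤ.* u₃)) h)
             (factor N k f₁ f₂ f₃ u₁ u₂ u₃))
    where
    split : ∀ N f₁ f₂ f₃ r₁ r₂ r₃ u₁ u₂ u₃ →
      f₁ ℤ.* (N ℤ.* (r₁ ℤ.+ + 2 ℤ.* u₁)) ℤ.+ f₂ ℤ.* (N ℤ.* (r₂ ℤ.+ + 2 ℤ.* u₂)) ℤ.+ f₃ ℤ.* (N ℤ.* (r₃ ℤ.+ + 2 ℤ.* u₃))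
      ≡ N ℤ.* (f₁ ℤ.* r₁ ℤ.+ f₂ ℤ.* r₂ ℤ.+ f₃ ℤ.* r₃) ℤ.+ N ℤ.* + 2 ℤ.* (f₁ ℤ.* u₁ ℤ.+ f₂ ℤ.* u₂ ℤ.+ f₃ ℤ.* u₃)
    split = solve-∀
    factor : ∀ N k f₁ f₂ f₃ u₁ u₂ u₃ →
      N ℤ.* (+ 2 ℤ.* k) ℤ.+ N ℤ.* + 2 ℤ.* (f₁ ℤ.* u₁ ℤ.+ f₂ ℤ.* u₂ ℤ.+ f₃ ℤ.* u₃)
      ≡ (N ℤ.* + 2) ℤ.* (k ℤ.+ (f₁ ℤ.* u₁ ℤ.+ f₂ ℤ.* u₂ ℤ.+ f₃ ℤ.* u₃))
    factor = solve-∀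

  linear-components : ∀ f₁ f₂ f₃ a₁ b₁ a₂ b₂ a₃ b₃ →
    fromℤ f₁ ⊗ (a₁ , b₁) ⊕ fromℤ f₂ ⊗ (a₂ , b₂) ⊕ fromℤ f₃ ⊗ (a₃ , b₃)
    ≡ (f₁ ℤ.* a₁ ℤ.+ f₂ ℤ.* a₂ ℤ.+ f₃ ℤ.* a₃ , f₁ ℤ.* b₁ ℤ.+ f₂ ℤ.* b₂ ℤ.+ f₃ ℤ.* b₃)
  linear-components f₁ f₂ f₃ a₁ b₁ a₂ b₂ a₃ b₃
    rewrite fromℤ-*-components f₁ a₁ b₁ | fromℤ-*-components f₂ a₂ b₂ | fromℤ-*-components f₃ a₃ b₃ =
    trans (cong (_⊕ _) (⊕-components _ _ _ _)) (⊕-components _ _ _ _)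

record SubsetSum (X₁ X₂ X₃ : ZA) : Set where
  constructor subsetSum
  field
    f₁ f₂ f₃ : Bool
    nontrivial : f₁ ∨ (f₂ ∨ f₃) ≡ true
    multiple-4-8 : Multiple (+ 4) (+ 8) (bitᴬ f₁ ⊗ X₁ ⊕ bitᴬ f₂ ⊗ X₂ ⊕ bitᴬ f₃ ⊗ X₃)

opaque
  subsetSum-4-8 : ∀ {X₁ X₂ X₃} → Multiple (+ 2) (+ 4) X₁ → Multiple (+ 2) (+ 4) X₂ → Multiple (+ 2) (+ 4) X₃ →
    SubsetSum X₁ X₂ X₃
  subsetSum-4-8 {X₁} {X₂} {X₃} (multiple x₁ y₁ e₁) (multiple x₂ y₂ e₂) (multiple x₃ y₃ e₃)
    with parity x₁ | parity x₂ | parity x₃ | parity y₁ | parity y₂ | parity y₃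
  ... | r₁ , u₁ , ex₁ | r₂ , u₂ , ex₂ | r₃ , u₃ , ex₃ | s₁ , v₁ , ey₁ | s₂ , v₂ , ey₂ | s₃ , v₃ , ey₃
    with F₂²-relation r₁ r₂ r₃ s₁ s₂ s₃
  ... | relation f₁ f₂ f₃ k k' r-even s-even nontrivial = subsetSum f₁ f₂ f₃ nontrivial (multiple _ _ (begin
    bitᴬ f₁ ⊗ X₁ ⊕ bitᴬ f₂ ⊗ X₂ ⊕ bitᴬ f₃ ⊗ X₃
      ≡⟨ cong₃ (λ u v w → bitᴬ f₁ ⊗ u ⊕ bitᴬ f₂ ⊗ v ⊕ bitᴬ f₃ ⊗ w) e₁ e₂ e₃ ⟩
    _ ≡⟨ linear-components _ _ _ _ _ _ _ _ _ ⟩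
    _ ≡⟨ pair≡ (trans (cong₃ (λ p q r → bit f₁ ℤ.* (+ 2 ℤ.* p) ℤ.+ bit f₂ ℤ.* (+ 2 ℤ.* q) ℤ.+ bit f₃ ℤ.* (+ 2 ℤ.* r)) ex₁ ex₂ ex₃)
                      (scale-relation (+ 2) (bit f₁) (bit f₂) (bit f₃) (bit r₁) (bit r₂) (bit r₃) u₁ u₂ u₃ k r-even))
               (trans (cong₃ (λ p q r → bit f₁ ℤ.* (+ 4 ℤ.* p) ℤ.+ bit f₂ ℤ.* (+ 4 ℤ.* q) ℤ.+ bit f₃ ℤ.* (+ 4 ℤ.* r)) ey₁ ey₂ ey₃)
                      (scale-relation (+ 4) (bit f₁) (bit f₂) (bit f₃) (bit s₁) (bit s₂) (bit s₃) v₁ v₂ v₃ k' s-even)) ⟩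
    _ ∎))
    where
    open ≡-Reasoning
    cong₃ : ∀ {A : Set} (f : A → A → A → A) {a a' b b' c c'} → a ≡ a' → b ≡ b' → c ≡ c' → f a b c ≡ f a' b' c'
    cong₃ f refl refl refl = refl

-- Turning the residue 1 of one odd term t into 5 = 1 + 4 adds 4t, which fixes the last bit.
opaque
  fix-mod-8 : ∀ {X t} → Multiple (+ 4) (+ 8) X → Odd t → Σ Bool λ z → Multiple (+ 8) (+ 8) (X ⊕ fromℤ (+ 4) ⊗ (bitᴬ z ⊗ t))
  fix-mod-8 {X} {t} (multiple τ τ' eX) (odd a c b et) with parity τ
  ... | false , τ₂ , eτ = false , multiple τ₂ τ'
    (trans (drop X t) (trans eX (pair≡ (trans (cong (+ 4 ℤ.*_) eτ) (double τ₂)) refl)))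
    where
    drop : ∀ X t → X ⊕ fromℤ (+ 4) ⊗ (fromℤ (+ 0) ⊗ t) ≡ X
    drop = solve 2 (λ X t → X :+ con (+ 4) :* (con (+ 0) :* t) := X) refl
    double : ∀ x → + 4 ℤ.* (+ 0 ℤ.+ + 2 ℤ.* x) ≡ + 8 ℤ.* x
    double = solve-∀
  ... | true , τ₂ , eτ = true , multiple (+ 1 ℤ.+ τ₂ ℤ.+ a) (τ' ℤ.+ bit c ℤ.+ + 2 ℤ.* b)
    (trans (keep X t) (trans (cong₂ (λ u v → u ⊕ fromℤ (+ 4) ⊗ v) eX et)
      (trans (cong (_ ⊕_) (fromℤ-*-components (+ 4) _ _)) (trans (⊕-components _ _ _ _)
        (pair≡ (trans (cong (λ u → + 4 ℤ.* u ℤ.+ + 4 ℤ.* (+ 1 ℤ.+ + 2 ℤ.* a)) eτ) (fst τ₂ a)) (snd τ' (bit c) b))))))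
    where
    keep : ∀ X t → X ⊕ fromℤ (+ 4) ⊗ (fromℤ (+ 1) ⊗ t) ≡ X ⊕ fromℤ (+ 4) ⊗ t
    keep = solve 2 (λ X t → X :+ con (+ 4) :* (con (+ 1) :* t) := X :+ con (+ 4) :* t) refl
    fst : ∀ x a → + 4 ℤ.* (+ 1 ℤ.+ + 2 ℤ.* x) ℤ.+ + 4 ℤ.* (+ 1 ℤ.+ + 2 ℤ.* a) ≡ + 8 ℤ.* (+ 1 ℤ.+ x ℤ.+ a)
    fst = solve-∀
    snd : ∀ x c b → + 8 ℤ.* x ℤ.+ + 4 ℤ.* (+ 2 ℤ.* c ℤ.+ + 4 ℤ.* b) ≡ + 8 ℤ.* (x ℤ.+ c ℤ.+ + 2 ℤ.* b)
    snd = solve-∀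

-- 0, 1 and 5 are the residues modulo 8 of d-th powers of 0, 1 and √5 (d = 2m, m odd).
powerResidue : Fin 3 → ZA
powerResidue fzero = 0ᴬ
powerResidue (fsuc fzero) = 1ᴬ
powerResidue (fsuc (fsuc fzero)) = fromℤ (+ 5)

residue : (used five : Bool) → Fin 3
residue false five = fzero
residue true false = fsuc fzero
residue true true = fsuc (fsuc fzero)

powerResidue-residue : ∀ used five → powerResidue (residue used five) ≡ bitᴬ used ⊗ (1ᴬ ⊕ fromℤ (+ 4) ⊗ bitᴬ five)
powerResidue-residue false false = sym (⊗-zeroˡ _)
powerResidue-residue false true = sym (⊗-zeroˡ _)
powerResidue-residue true false = solve 0 (con (+ 1) := con (+ 1) :* (con (+ 1) :+ con (+ 4) :* con (+ 0))) refl
powerResidue-residue true true = solve 0 (con (+ 5) := con (+ 1) :* (con (+ 1) :+ con (+ 4) :* con (+ 1))) refl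

residue-used≢0 : ∀ five → ¬ (residue true five ≡ fzero)
residue-used≢0 false ()
residue-used≢0 true ()

twice : Bool → ZA → ZA
twice δ w = bitᴬ δ ⊗ (fromℤ (+ 2) ⊗ w)

record ResidueSolution (s : Fin 6 → ZA) (w : ZA) : Set where
  field
    π : Fin 6 → Fin 6
    π-injective : Injective _≡_ _≡_ π
    e : Fin 6 → Fin 3
    δ : Bool
    j : Fin 6
    e-j≢0 : ¬ (e j ≡ fzero)
    sum≈0 : ∑ᴬ 6 (λ i → s (π i) ⊗ powerResidue (e i)) ⊕ twice δ w ≈[ + 8 ] 0ᴬ

-- Pair the six odd terms by colour: each pair lies in 2ℤ ⊕ 4ℤα, and so does a third block built from
-- the leftover terms and 2w. A nonempty subsum of the blocks then lies in 4ℤ ⊕ 8ℤα, and fix-mod-8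
-- finishes.
module OddResidues (s : Fin 6 → ZA) (w : ZA) (s-odd : ∀ i → s i ≈[ + 2 ] 1ᴬ) (w≉0 : ¬ (w ≈[ + 2 ] 0ᴬ)) where

  colour : Fin 6 → Bool
  colour i = Odd.colour (odd-decompose (s-odd i))

  open Pairing (pairUp colour)

  t : Fin 6 → ZA
  t i = s (π i)

  o : ∀ i → Odd (t i)
  o i = odd-decompose (s-odd (π i))

  four : ZA
  four = fromℤ (+ 4)

  thirdBlock : (pair withW : Bool) → ZA
  thirdBlock pair withW = bitᴬ pair ⊗ (t #4 ⊕ t #5) ⊕ bitᴬ withW ⊗ (fromℤ (+ 2) ⊗ w)

  choice : (f₁ f₂ f₃ z₁ z₂ z₃ : Bool) → Fin 6 → Fin 3
  choice f₁ f₂ f₃ z₁ z₂ z₃ fzero = residue f₁ z₁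
  choice f₁ f₂ f₃ z₁ z₂ z₃ (fsuc fzero) = residue f₁ false
  choice f₁ f₂ f₃ z₁ z₂ z₃ (fsuc (fsuc fzero)) = residue f₂ z₂
  choice f₁ f₂ f₃ z₁ z₂ z₃ (fsuc (fsuc (fsuc fzero))) = residue f₂ false
  choice f₁ f₂ f₃ z₁ z₂ z₃ (fsuc (fsuc (fsuc (fsuc fzero)))) = residue f₃ z₃
  choice f₁ f₂ f₃ z₁ z₂ z₃ (fsuc (fsuc (fsuc (fsuc (fsuc fzero))))) = residue f₃ false

  blocks : (f₁ f₂ f₃ pair withW z₁ z₂ z₃ : Bool) → ZA
  blocks f₁ f₂ f₃ pair withW z₁ z₂ z₃ =
    (bitᴬ f₁ ⊗ (t #0 ⊕ t #1) ⊕ bitᴬ f₂ ⊗ (t #2 ⊕ t #3) ⊕ bitᴬ f₃ ⊗ thirdBlock pair withW)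
    ⊕ four ⊗ (bitᴬ f₁ ⊗ bitᴬ z₁ ⊗ t #0 ⊕ bitᴬ f₂ ⊗ bitᴬ z₂ ⊗ t #2 ⊕ bitᴬ f₃ ⊗ bitᴬ pair ⊗ bitᴬ z₃ ⊗ t #4)

  sum-as-blocks : ∀ f₁ f₂ f₃ pair withW z₁ z₂ z₃ →
    ∑ᴬ 6 (λ i → t i ⊗ powerResidue (choice f₁ f₂ (f₃ ∧ pair) z₁ z₂ z₃ i)) ⊕ twice (f₃ ∧ withW) w
    ≡ blocks f₁ f₂ f₃ pair withW z₁ z₂ z₃
  sum-as-blocks f₁ f₂ f₃ pair withW z₁ z₂ z₃ =
    trans (cong₂ _⊕_ (∑ᴬ-ext 6 λ i → cong (t i ⊗_) (residues i)) (cong (_⊗ (fromℤ (+ 2) ⊗ w)) (bitᴬ-∧ f₃ withW)))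
          (regroup (t #0) (t #1) (t #2) (t #3) (t #4) (t #5) w (bitᴬ f₁) (bitᴬ f₂) (bitᴬ f₃) (bitᴬ pair) (bitᴬ withW)
                   (bitᴬ z₁) (bitᴬ z₂) (bitᴬ z₃))
    where
    F₃ : ZA
    F₃ = bitᴬ f₃ ⊗ bitᴬ pair
    expected : Fin 6 → ZA
    expected fzero = bitᴬ f₁ ⊗ (1ᴬ ⊕ four ⊗ bitᴬ z₁)
    expected (fsuc fzero) = bitᴬ f₁ ⊗ (1ᴬ ⊕ four ⊗ 0ᴬ)
    expected (fsuc (fsuc fzero)) = bitᴬ f₂ ⊗ (1ᴬ ⊕ four ⊗ bitᴬ z₂)
    expected (fsuc (fsuc (fsuc fzero))) = bitᴬ f₂ ⊗ (1ᴬ ⊕ four ⊗ 0ᴬ)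
    expected (fsuc (fsuc (fsuc (fsuc fzero)))) = F₃ ⊗ (1ᴬ ⊕ four ⊗ bitᴬ z₃)
    expected (fsuc (fsuc (fsuc (fsuc (fsuc fzero))))) = F₃ ⊗ (1ᴬ ⊕ four ⊗ 0ᴬ)
    residues : ∀ i → powerResidue (choice f₁ f₂ (f₃ ∧ pair) z₁ z₂ z₃ i) ≡ expected i
    residues fzero = powerResidue-residue f₁ z₁
    residues (fsuc fzero) = powerResidue-residue f₁ false
    residues (fsuc (fsuc fzero)) = powerResidue-residue f₂ z₂
    residues (fsuc (fsuc (fsuc fzero))) = powerResidue-residue f₂ false
    residues (fsuc (fsuc (fsuc (fsuc fzero)))) =
      trans (powerResidue-residue (f₃ ∧ pair) z₃) (cong (_⊗ (1ᴬ ⊕ four ⊗ bitᴬ z₃)) (bitᴬ-∧ f₃ pair))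
    residues (fsuc (fsuc (fsuc (fsuc (fsuc fzero))))) =
      trans (powerResidue-residue (f₃ ∧ pair) false) (cong (_⊗ (1ᴬ ⊕ four ⊗ 0ᴬ)) (bitᴬ-∧ f₃ pair))
    regroup : ∀ t₀ t₁ t₂ t₃ t₄ t₅ w F₁ F₂ F₃ P W Z₁ Z₂ Z₃ →
      t₀ ⊗ (F₁ ⊗ (1ᴬ ⊕ fromℤ (+ 4) ⊗ Z₁)) ⊕ (t₁ ⊗ (F₁ ⊗ (1ᴬ ⊕ fromℤ (+ 4) ⊗ 0ᴬ))
        ⊕ (t₂ ⊗ (F₂ ⊗ (1ᴬ ⊕ fromℤ (+ 4) ⊗ Z₂)) ⊕ (t₃ ⊗ (F₂ ⊗ (1ᴬ ⊕ fromℤ (+ 4) ⊗ 0ᴬ))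
        ⊕ (t₄ ⊗ ((F₃ ⊗ P) ⊗ (1ᴬ ⊕ fromℤ (+ 4) ⊗ Z₃)) ⊕ (t₅ ⊗ ((F₃ ⊗ P) ⊗ (1ᴬ ⊕ fromℤ (+ 4) ⊗ 0ᴬ)) ⊕ 0ᴬ)))))
        ⊕ (F₃ ⊗ W) ⊗ (fromℤ (+ 2) ⊗ w)
      ≡ (F₁ ⊗ (t₀ ⊕ t₁) ⊕ F₂ ⊗ (t₂ ⊕ t₃) ⊕ F₃ ⊗ (P ⊗ (t₄ ⊕ t₅) ⊕ W ⊗ (fromℤ (+ 2) ⊗ w)))
        ⊕ fromℤ (+ 4) ⊗ (F₁ ⊗ Z₁ ⊗ t₀ ⊕ F₂ ⊗ Z₂ ⊗ t₂ ⊕ F₃ ⊗ P ⊗ Z₃ ⊗ t₄)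
    regroup = solve 15 (λ t₀ t₁ t₂ t₃ t₄ t₅ w F₁ F₂ F₃ P W Z₁ Z₂ Z₃ →
      t₀ :* (F₁ :* (con (+ 1) :+ con (+ 4) :* Z₁)) :+ (t₁ :* (F₁ :* (con (+ 1) :+ con (+ 4) :* con (+ 0)))
        :+ (t₂ :* (F₂ :* (con (+ 1) :+ con (+ 4) :* Z₂)) :+ (t₃ :* (F₂ :* (con (+ 1) :+ con (+ 4) :* con (+ 0)))
        :+ (t₄ :* ((F₃ :* P) :* (con (+ 1) :+ con (+ 4) :* Z₃))
        :+ (t₅ :* ((F₃ :* P) :* (con (+ 1) :+ con (+ 4) :* con (+ 0))) :+ con (+ 0))))))
        :+ (F₃ :* W) :* (con (+ 2) :* w)
      := (F₁ :* (t₀ :+ t₁) :+ F₂ :* (t₂ :+ t₃) :+ F₃ :* (P :* (t₄ :+ t₅) :+ W :* (con (+ 2) :* w)))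
        :+ con (+ 4) :* (F₁ :* Z₁ :* t₀ :+ F₂ :* Z₂ :* t₂ :+ F₃ :* P :* Z₃ :* t₄)) refl

  solution : ∀ f₁ f₂ f₃ pair withW z₁ z₂ z₃ j → ¬ (choice f₁ f₂ (f₃ ∧ pair) z₁ z₂ z₃ j ≡ fzero) →
    Multiple (+ 8) (+ 8) (blocks f₁ f₂ f₃ pair withW z₁ z₂ z₃) → ResidueSolution s w
  solution f₁ f₂ f₃ pair withW z₁ z₂ z₃ j e-j≢0 m = record
    { π = π ; π-injective = π-injective ; e = choice f₁ f₂ (f₃ ∧ pair) z₁ z₂ z₃ ; δ = f₃ ∧ withW ; j = j
    ; e-j≢0 = e-j≢0 ; sum≈0 = Multiple-8⇒≈0 (subst (Multiple (+ 8) (+ 8)) (sym (sum-as-blocks f₁ f₂ f₃ pair withW z₁ z₂ z₃)) m) }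

  fromSubsetSum : ∀ pair withW → Multiple (+ 2) (+ 4) (thirdBlock pair withW) →
    (pair ≡ false → ¬ Multiple (+ 4) (+ 8) (bitᴬ withW ⊗ (fromℤ (+ 2) ⊗ w))) → ResidueSolution s w
  fromSubsetSum pair withW third no-lone-w
    with subsetSum-4-8 (sameColour-pair (o #0) (o #1) pair₀₁) (sameColour-pair (o #2) (o #3) pair₂₃) third
  ... | subsetSum true f₂ f₃ _ m with fix-mod-8 m (o #0)
  ...   | z , m' = solution true f₂ f₃ pair withW z false false #0 (residue-used≢0 z)
                     (subst (λ u → Multiple (+ 8) (+ 8) (_ ⊕ four ⊗ u)) (sym (only-first _ _ _ _ _ _ _)) m')
    where
    only-first : ∀ F₂ F₃ P z t₀ t₂ t₄ → 1ᴬ ⊗ z ⊗ t₀ ⊕ F₂ ⊗ 0ᴬ ⊗ t₂ ⊕ F₃ ⊗ P ⊗ 0ᴬ ⊗ t₄ ≡ z ⊗ t₀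
    only-first = solve 7 (λ F₂ F₃ P z t₀ t₂ t₄ →
      con (+ 1) :* z :* t₀ :+ F₂ :* con (+ 0) :* t₂ :+ F₃ :* P :* con (+ 0) :* t₄ := z :* t₀) refl
  fromSubsetSum pair withW third no-lone-w | subsetSum false true f₃ _ m with fix-mod-8 m (o #2)
  ...   | z , m' = solution false true f₃ pair withW false z false #2 (residue-used≢0 z)
                     (subst (λ u → Multiple (+ 8) (+ 8) (_ ⊕ four ⊗ u)) (sym (only-second _ _ _ _ _ _)) m')
    where
    only-second : ∀ F₃ P z t₀ t₂ t₄ → 0ᴬ ⊗ 0ᴬ ⊗ t₀ ⊕ 1ᴬ ⊗ z ⊗ t₂ ⊕ F₃ ⊗ P ⊗ 0ᴬ ⊗ t₄ ≡ z ⊗ t₂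
    only-second = solve 6 (λ F₃ P z t₀ t₂ t₄ →
      con (+ 0) :* con (+ 0) :* t₀ :+ con (+ 1) :* z :* t₂ :+ F₃ :* P :* con (+ 0) :* t₄ := z :* t₂) refl
  fromSubsetSum true withW third no-lone-w | subsetSum false false true _ m with fix-mod-8 m (o #4)
  ...   | z , m' = solution false false true true withW false false z #4 (residue-used≢0 z)
                     (subst (λ u → Multiple (+ 8) (+ 8) (_ ⊕ four ⊗ u)) (sym (only-third _ _ _ _)) m')
    where
    only-third : ∀ z t₀ t₂ t₄ → 0ᴬ ⊗ 0ᴬ ⊗ t₀ ⊕ 0ᴬ ⊗ 0ᴬ ⊗ t₂ ⊕ 1ᴬ ⊗ 1ᴬ ⊗ z ⊗ t₄ ≡ z ⊗ t₄
    only-third = solve 4 (λ z t₀ t₂ t₄ →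
      con (+ 0) :* con (+ 0) :* t₀ :+ con (+ 0) :* con (+ 0) :* t₂ :+ con (+ 1) :* con (+ 1) :* z :* t₄ := z :* t₄) refl
  fromSubsetSum false withW third no-lone-w | subsetSum false false true _ m =
    ⊥-elim (no-lone-w refl (subst (Multiple (+ 4) (+ 8)) (lone-w _ _ _ _) m))
    where
    lone-w : ∀ X₁ X₂ Y V → 0ᴬ ⊗ X₁ ⊕ 0ᴬ ⊗ X₂ ⊕ 1ᴬ ⊗ (0ᴬ ⊗ Y ⊕ V) ≡ V
    lone-w = solve 4 (λ X₁ X₂ Y V → con (+ 0) :* X₁ :+ con (+ 0) :* X₂ :+ con (+ 1) :* (con (+ 0) :* Y :+ V) := V) refl
  fromSubsetSum pair withW third no-lone-w | subsetSum false false false () m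

  residueSolution : ResidueSolution s w
  residueSolution with Odd.colour (o #4) == Odd.colour (o #5) in same | unitShape w w≉0
  ... | true | _ = fromSubsetSum true false
    (subst (Multiple (+ 2) (+ 4)) (pair-only _ _) (sameColour-pair (o #4) (o #5) (==-true same))) (λ ())
    where
    pair-only : ∀ a b → a ≡ 1ᴬ ⊗ a ⊕ 0ᴬ ⊗ b
    pair-only = solve 2 (λ a b → a := con (+ 1) :* a :+ con (+ 0) :* b) refl
  ... | false | α-odd P Q w≡ = fromSubsetSum true true
    (subst (Multiple (+ 2) (+ 4)) (pair-and-w _ _) (differentColour-pair (o #4) (o #5) same P Q w≡)) (λ ())
    where
    pair-and-w : ∀ a b → a ⊕ b ≡ 1ᴬ ⊗ a ⊕ 1ᴬ ⊗ b
    pair-and-w = solve 2 (λ a b → a :+ b := con (+ 1) :* a :+ con (+ 1) :* b) refl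
  ... | false | α-even P Q w≡ = fromSubsetSum false true
    (subst (Multiple (+ 2) (+ 4)) (w-only _ _) (twice-α-even P Q w≡))
    (λ _ m → twice-α-even-not-4 P Q w≡ (subst (Multiple (+ 4) (+ 8)) (⊗-identityˡ _) m))
    where
    w-only : ∀ a b → b ≡ 0ᴬ ⊗ a ⊕ 1ᴬ ⊗ b
    w-only = solve 2 (λ a b → b := con (+ 0) :* a :+ con (+ 1) :* b) refl

record ClassRepresentative (c : ZA) : Set where
  field
    rep rep⁻¹ : ZA
    rep-inverse : rep ⊗ rep⁻¹ ≡ 1ᴬ
    c≈rep : c ≈[ + 2 ] rep

opaque
  unfolding _⊗_

  α-inverse : (+ 0 , + 1) ⊗ (-[1+ 0 ] , + 1) ≡ 1ᴬ
  α-inverse = refl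

  1+α-inverse : (+ 1 , + 1) ⊗ (+ 2 , -[1+ 0 ]) ≡ 1ᴬ
  1+α-inverse = refl

classRepresentative : ∀ c → ¬ (c ≈[ + 2 ] 0ᴬ) → ClassRepresentative c
classRepresentative (c₁ , c₂) c≉0 with parity c₁ | parity c₂
... | true , q₁ , e₁ | false , q₂ , e₂ =
  record { rep = 1ᴬ ; rep⁻¹ = 1ᴬ ; rep-inverse = ⊗-identityˡ 1ᴬ ; c≈rep = ≈-fromComponents q₁ q₂ (pair≡ e₁ e₂) }
... | false , q₁ , e₁ | true , q₂ , e₂ =
  record { rep = + 0 , + 1 ; rep⁻¹ = -[1+ 0 ] , + 1 ; rep-inverse = α-inverse ; c≈rep = ≈-fromComponents q₁ q₂ (pair≡ e₁ e₂) }
... | true , q₁ , e₁ | true , q₂ , e₂ =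
  record { rep = + 1 , + 1 ; rep⁻¹ = + 2 , -[1+ 0 ] ; rep-inverse = 1+α-inverse ; c≈rep = ≈-fromComponents q₁ q₂ (pair≡ e₁ e₂) }
... | false , q₁ , e₁ | false , q₂ , e₂ = ⊥-elim (c≉0 (≈-fromComponents q₁ q₂ (pair≡ e₁ e₂)))

-- Dividing by a representative of the common class reduces to the case of odd terms.
residueSolution : (σ : Fin 6 → ZA) (c w : ZA) → (∀ i → σ i ≈[ + 2 ] c) → ¬ (c ≈[ + 2 ] 0ᴬ) → ¬ (w ≈[ + 2 ] 0ᴬ) →
  ResidueSolution σ w
residueSolution σ c w σ≈c c≉0 w≉0 = record
  { π = π ; π-injective = π-injective ; e = e ; δ = δ ; j = j ; e-j≢0 = e-j≢0 ; sum≈0 = sum≈0′ }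
  where
  open ClassRepresentative (classRepresentative c c≉0)
  s : Fin 6 → ZA
  s i = rep⁻¹ ⊗ σ i
  s-odd : ∀ i → s i ≈[ + 2 ] 1ᴬ
  s-odd i = ≈-trans (⊗-congˡ rep⁻¹ (≈-trans (σ≈c i) c≈rep)) (≈-reflexive (trans (⊗-comm rep⁻¹ rep) rep-inverse))
  unscale : ∀ x → rep ⊗ (rep⁻¹ ⊗ x) ≡ x
  unscale x = trans (sym (⊗-assoc rep rep⁻¹ x)) (trans (cong (_⊗ x) rep-inverse) (⊗-identityˡ x))
  w'≉0 : ¬ (rep⁻¹ ⊗ w ≈[ + 2 ] 0ᴬ)
  w'≉0 h = w≉0 (≈-trans (≈-reflexive (sym (unscale w))) (≈-trans (⊗-congˡ rep h) (≈-reflexive (⊗-zeroʳ rep))))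
  open ResidueSolution (OddResidues.residueSolution s (rep⁻¹ ⊗ w) s-odd w'≉0)
  X : ZA
  X = ∑ᴬ 6 (λ i → σ (π i) ⊗ powerResidue (e i)) ⊕ twice δ w
  scaled : rep⁻¹ ⊗ X ≡ ∑ᴬ 6 (λ i → s (π i) ⊗ powerResidue (e i)) ⊕ twice δ (rep⁻¹ ⊗ w)
  scaled = trans (distribute rep⁻¹ (∑ᴬ 6 (λ i → σ (π i) ⊗ powerResidue (e i))) (bitᴬ δ) w)
    (cong (_⊕ twice δ (rep⁻¹ ⊗ w))
      (trans (sym (∑ᴬ-⊗ 6 rep⁻¹ (λ i → σ (π i) ⊗ powerResidue (e i))))
             (∑ᴬ-ext 6 (λ i → sym (⊗-assoc rep⁻¹ (σ (π i)) (powerResidue (e i)))))))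
    where
    distribute : ∀ l S d w → l ⊗ (S ⊕ d ⊗ (fromℤ (+ 2) ⊗ w)) ≡ l ⊗ S ⊕ d ⊗ (fromℤ (+ 2) ⊗ (l ⊗ w))
    distribute = solve 4 (λ l S d w → l :* (S :+ d :* (con (+ 2) :* w)) := l :* S :+ d :* (con (+ 2) :* (l :* w))) refl
  sum≈0′ : X ≈[ + 8 ] 0ᴬ
  sum≈0′ = ≈-trans (≈-reflexive (sym (unscale X)))
             (≈-trans (⊗-congˡ rep (≈-trans (≈-reflexive scaled) sum≈0)) (≈-reflexive (⊗-zeroʳ rep)))

-- a = 2^v U with U a unit of 𝒪 and v ≡ k (mod d), in the form 2^p a = 2^q U with q = p + den a + v.
record LevelWitness (d : ℕ) (a : K) (k : ℤ) : Set where
  field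
    U W : Seq
    U-coherent : Coherent U
    W-coherent : Coherent W
    UW≈1 : ∀ n → U n ⊗ W n ≈[ two^ n ] 1ᴬ
    p q : ℕ
    scaled : ∀ n → 2^ᴬ p ⊗ num a n ≈[ two^ n ] 2^ᴬ q ⊗ U n
    v t : ℤ
    q≡p+den+v : + q ≡ + p ℤ.+ + den a ℤ.+ v
    v≡k+dt : v ≡ k ℤ.+ + d ℤ.* t

levelWitness : ∀ d a k v u w → IsO u → IsO w → (u *O w) ≈O 1O → a ≈K (pow2K v *K ιK u) → (+ d) ∣ (v ℤ.- k) →
  LevelWitness d a k
levelWitness d a k v u w hu hw uw≈1 a≈ d∣v-k = record
  { U = u ; W = w ; U-coherent = IsO⇒Coherent {u} hu ; W-coherent = IsO⇒Coherent {w} hw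
  ; UW≈1 = λ n → subst (λ z → z ≈[ two^ n ] 1ᴬ) (sym (⊗-def (u n) (w n))) (≡[modᴬ]⇒≈ (uw≈1 n))
  ; p = P v ; q = Q v ; scaled = scaled v a≈ ; v = v ; t = ℤS._∣_.quotient d∣v-k′
  ; q≡p+den+v = exponents v ; v≡k+dt = v≡k+dt }
  where
  d∣v-k′ : (+ d) ℤS.∣ (v ℤ.- k)
  d∣v-k′ = ℤS.∣ᵤ⇒∣ {+ d} {v ℤ.- k} d∣v-k
  v≡k+dt : v ≡ k ℤ.+ + d ℤ.* ℤS._∣_.quotient d∣v-k′
  v≡k+dt = trans (split v k) (cong (λ z → k ℤ.+ z) (trans (ℤS._∣_.equality d∣v-k′) (ℤP.*-comm _ (+ d))))
    where
    split : ∀ v k → v ≡ k ℤ.+ (v ℤ.- k)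
    split = solve-∀
  P Q : ℤ → ℕ
  P (+ n) = 0
  P -[1+ n ] = suc n ℕ.+ 0
  Q (+ n) = den a ℕ.+ n
  Q -[1+ n ] = den a
  scaled : ∀ v → a ≈K (pow2K v *K ιK u) → ∀ n → 2^ᴬ (P v) ⊗ num a n ≈[ two^ n ] 2^ᴬ (Q v) ⊗ u n
  scaled (+ m) h n = subst₂ (λ x y → x ≈[ two^ n ] y) (sym (⊗-def _ _))
    (trans (sym (trans (⊗-def _ _) (cong (2^ᴬ (den a) *ᴬ_) (⊗-def _ _))))
           (trans (sym (⊗-assoc _ _ _)) (cong (_⊗ u n) (sym (2^ᴬ-+ (den a) m)))))
    (≡[modᴬ]⇒≈ (h n))
  scaled -[1+ m ] h n = subst₂ (λ x y → x ≈[ two^ n ] y) (sym (⊗-def _ _))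
    (trans (sym (trans (⊗-def _ _) (cong (2^ᴬ (den a) *ᴬ_) (⊗-def _ _)))) (cong (2^ᴬ (den a) ⊗_) (⊗-identityˡ (u n))))
    (≡[modᴬ]⇒≈ (h n))
  exponents : ∀ v → + Q v ≡ + P v ℤ.+ + den a ℤ.+ v
  exponents (+ m) = trans (ℤP.pos-+ (den a) m) (cong (ℤ._+ + m) (sym (ℤP.+-identityˡ (+ den a))))
  exponents -[1+ m ] = trans (add-sub (+ den a) (+ suc m))
    (cong (λ z → + z ℤ.+ + den a ℤ.+ -[1+ m ]) (sym (ℕP.+-identityʳ (suc m))))
    where
    add-sub : ∀ x y → x ≡ y ℤ.+ x ℤ.+ ℤ.- y
    add-sub = solve-∀

HasLevel⇒LevelWitness : ∀ {d a k} → HasLevel d a k → LevelWitness d a k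
HasLevel⇒LevelWitness {d} {a} {k} (_ , v , u , hu , (w , hw , uw≈1) , a≈ , d∣v-k) =
  levelWitness d a k v u w hu hw uw≈1 a≈ d∣v-k

HasLevelClass⇒LevelWitness : ∀ {d a k c} → HasLevelClass d a k c → Σ (LevelWitness d a k) λ L → LevelWitness.U L 1 ≈[ + 2 ] c
HasLevelClass⇒LevelWitness {d} {a} {k} (_ , v , u , hu , (w , hw , uw≈1) , a≈ , d∣v-k , class) =
  levelWitness d a k v u w hu hw uw≈1 a≈ d∣v-k , ≡[modᴬ]⇒≈ class

unit-odd : ∀ {U W : Seq} → (∀ n → U n ⊗ W n ≈[ two^ n ] 1ᴬ) → ¬ (U 1 ≈[ + 2 ] 0ᴬ)
unit-odd {U} {W} UW≈1 U≈0 =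
  1≉0 (≈-trans (≈-sym (UW≈1 1)) (≈-trans (⊗-cong U≈0 (≈-refl {W 1})) (≈-reflexive (⊗-zeroˡ (W 1)))))

unit-not-even : ∀ {U W V : Seq} → (∀ n → U n ⊗ W n ≈[ two^ n ] 1ᴬ) → Coherent U → Coherent V → ∀ A o →
  ¬ (∀ n → 2^ᴬ A ⊗ U n ≈[ two^ n ] 2^ᴬ (A ℕ.+ suc o) ⊗ V n)
unit-not-even {U} {W} {V} UW≈1 U-coh V-coh A o h =
  unit-odd {U} {W} UW≈1 (≈-trans (cancel-2^ᴬ A U-coh 2V-coh h′ 1) (2^ᴬ o ⊗ V 1 , even))
  where
  2V-coh : Coherent (λ n → 2^ᴬ (suc o) ⊗ V n)
  2V-coh = coherent-⊗ {λ _ → 2^ᴬ (suc o)} {V} (coherent-const _) V-coh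
  h′ : ∀ n → 2^ᴬ A ⊗ U n ≈[ two^ n ] 2^ᴬ A ⊗ (2^ᴬ (suc o) ⊗ V n)
  h′ n = ≈-trans (h n) (≈-reflexive (2^ᴬ-+-assoc A (suc o) (V n)))
  even : 2^ᴬ (suc o) ⊗ V 1 ≡ 0ᴬ ⊕ fromℤ (+ 2) ⊗ (2^ᴬ o ⊗ V 1)
  even = trans (cong (_⊗ V 1) (2^ᴬ-suc o)) (trans (⊗-assoc _ _ _) (sym (⊕-identityˡ _)))

d*x≢1 : ∀ d x → 2 ℕ.≤ d → ¬ (+ d ℤ.* x ≡ + 1)
d*x≢1 d x 2≤d eq with ℕP.m*n≡1⇒m≡1 d ℤ.∣ x ∣ (trans (sym (ℤP.abs-* (+ d) x)) (cong ℤ.∣_∣ eq))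
d*x≢1 .1 x (ℕ.s≤s ()) eq | refl

unit-parts : ∀ {d a k k′} (L : LevelWitness d a k) (L′ : LevelWitness d a k′) → let module L = LevelWitness L; module L′ = LevelWitness L′ in
  ∀ n → 2^ᴬ (L′.p ℕ.+ L.q) ⊗ L.U n ≈[ two^ n ] 2^ᴬ (L.p ℕ.+ L′.q) ⊗ L′.U n
unit-parts {a = a} L L′ n =
  ≈-trans (≈-reflexive (2^ᴬ-+-assoc L′.p L.q (L.U n)))
    (≈-trans (⊗-congˡ (2^ᴬ L′.p) (≈-sym (L.scaled n)))
      (≈-trans (≈-reflexive (swap (2^ᴬ L′.p) (2^ᴬ L.p) (num a n)))
        (≈-trans (⊗-congˡ (2^ᴬ L.p) (L′.scaled n)) (≈-reflexive (sym (2^ᴬ-+-assoc L.p L′.q (L′.U n)))))))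
  where
  module L = LevelWitness L
  module L′ = LevelWitness L′
  swap : ∀ a b x → a ⊗ (b ⊗ x) ≡ b ⊗ (a ⊗ x)
  swap = solve 3 (λ a b x → a :* (b :* x) := b :* (a :* x)) refl

-- Units on both sides force p′ + q = p + q′, i.e. equal valuations, which are k and k + 1 modulo d.
module _ {d a k} (2≤d : 2 ℕ.≤ d) (L : LevelWitness d a k) (L′ : LevelWitness d a (k ℤ.+ + 1)) where
  private
    module L = LevelWitness L
    module L′ = LevelWitness L′

  levels-distinct : ⊥
  levels-distinct with ℕP.<-cmp (L′.p ℕ.+ L.q) (L.p ℕ.+ L′.q)
  ... | tri< lt _ _ with ℕP.m≤n⇒∃[o]m+o≡n lt
  ...   | o , eo = unit-not-even {L.U} {L.W} {L′.U} L.UW≈1 L.U-coherent L′.U-coherent (L′.p ℕ.+ L.q) o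
            (λ n → subst (λ z → 2^ᴬ (L′.p ℕ.+ L.q) ⊗ L.U n ≈[ two^ n ] 2^ᴬ z ⊗ L′.U n)
                         (sym (trans (ℕP.+-suc (L′.p ℕ.+ L.q) o) eo)) (unit-parts L L′ n))
  levels-distinct | tri> _ _ gt with ℕP.m≤n⇒∃[o]m+o≡n gt
  ...   | o , eo = unit-not-even {L′.U} {L′.W} {L.U} L′.UW≈1 L′.U-coherent L.U-coherent (L.p ℕ.+ L′.q) o
            (λ n → subst (λ z → 2^ᴬ (L.p ℕ.+ L′.q) ⊗ L′.U n ≈[ two^ n ] 2^ᴬ z ⊗ L.U n)
                         (sym (trans (ℕP.+-suc (L.p ℕ.+ L′.q) o) eo)) (≈-sym (unit-parts L L′ n)))
  levels-distinct | tri≈ _ eq _ =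
    d*x≢1 d (L.t ℤ.- L′.t) 2≤d
      (difference (+ L.p) (+ L′.p) (+ L.q) (+ L′.q) (+ den a) k (+ d) L.t L′.t
        (trans L.q≡p+den+v (cong (λ z → + L.p ℤ.+ + den a ℤ.+ z) L.v≡k+dt))
        (trans L′.q≡p+den+v (cong (λ z → + L′.p ℤ.+ + den a ℤ.+ z) L′.v≡k+dt))
        (trans (sym (ℤP.pos-+ L′.p L.q)) (trans (cong +_ eq) (ℤP.pos-+ L.p L′.q))))
    where
    difference : ∀ p p′ q q′ D k d t t′ → q ≡ p ℤ.+ D ℤ.+ (k ℤ.+ d ℤ.* t) → q′ ≡ p′ ℤ.+ D ℤ.+ ((k ℤ.+ + 1) ℤ.+ d ℤ.* t′) →
      p′ ℤ.+ q ≡ p ℤ.+ q′ → d ℤ.* (t ℤ.- t′) ≡ + 1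
    difference p p′ _ _ D k d t t′ refl refl eq =
      trans (expand p p′ D k d t t′) (trans (cong (λ z → z ℤ.- rhs ℤ.+ + 1) eq) (cancel rhs))
      where
      rhs : ℤ
      rhs = p ℤ.+ (p′ ℤ.+ D ℤ.+ ((k ℤ.+ + 1) ℤ.+ d ℤ.* t′))
      expand : ∀ p p′ D k d t t′ → d ℤ.* (t ℤ.- t′)
        ≡ p′ ℤ.+ (p ℤ.+ D ℤ.+ (k ℤ.+ d ℤ.* t)) ℤ.- (p ℤ.+ (p′ ℤ.+ D ℤ.+ ((k ℤ.+ + 1) ℤ.+ d ℤ.* t′))) ℤ.+ + 1
      expand = solve-∀
      cancel : ∀ x → x ℤ.- x ℤ.+ + 1 ≡ + 1
      cancel = solve-∀


-- From a zero of the normalised form to a zero of f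

∑ℕ : (n : ℕ) → (Fin n → ℕ) → ℕ
∑ℕ zero f = 0
∑ℕ (suc n) f = f fzero ℕ.+ ∑ℕ n (λ i → f (fsuc i))

∑ℕ-term : ∀ n f (i : Fin n) → Σ ℕ λ r → ∑ℕ n f ≡ f i ℕ.+ r
∑ℕ-term (suc n) f fzero = ∑ℕ n (λ i → f (fsuc i)) , refl
∑ℕ-term (suc n) f (fsuc i) with ∑ℕ-term n (λ i → f (fsuc i)) i
... | r , e = f fzero ℕ.+ r , trans (cong (f fzero ℕ.+_) e) (swap (f fzero) (f (fsuc i)) r)
  where
  swap : ∀ a b r → a ℕ.+ (b ℕ.+ r) ≡ b ℕ.+ (a ℕ.+ r)
  swap = ℕSolver.solve-∀

-- The exponents of one term x = Y / 2^f: 2^E = 2^(p + e) and f = M + t.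
record TermExponents (E M p : ℕ) (t : ℤ) : Set where
  constructor termExponents
  field
    e f : ℕ
    E≡p+e : E ≡ p ℕ.+ e
    f≡M+t : + f ≡ + M ℤ.+ t

record CommonExponents (d′ : ℕ) (k : ℤ) (n : ℕ) (p : Fin n → ℕ) (t : Fin n → ℤ) : Set where
  field
    E M : ℕ
    E+k≡dM : + E ℤ.+ k ≡ + suc d′ ℤ.* + M
    term : ∀ u → TermExponents E M (p u) (t u)

-- With X = ∑ (p u + |t u|) and M = max(k, 0) + X, E = dM - k exceeds every p u and every f = M + t u ≥ 0.
commonExponents : ∀ d′ k n p t → CommonExponents d′ k n p t
commonExponents d′ k n p t = forK k
  where
  X : ℕ
  X = ∑ℕ n (λ u → p u ℕ.+ ℤ.∣ t u ∣)
  rearrange : ∀ a P q r y → a ℕ.+ (P ℕ.+ q ℕ.+ r ℕ.+ y) ≡ P ℕ.+ (a ℕ.+ q ℕ.+ r ℕ.+ y)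
  rearrange = ℕSolver.solve-∀
  split : ∀ a x P q r y → x ≡ P ℕ.+ q ℕ.+ r → a ℕ.+ (x ℕ.+ y) ≡ P ℕ.+ (a ℕ.+ q ℕ.+ r ℕ.+ y)
  split a x P q r y refl = rearrange a P q r y
  term : ∀ (a k⁺ E : ℕ) → E ≡ a ℕ.+ suc d′ ℕ.* X → ∀ u → TermExponents E (k⁺ ℕ.+ X) (p u) (t u)
  term a k⁺ E E≡ u with t u | ∑ℕ-term n (λ u → p u ℕ.+ ℤ.∣ t u ∣) u
  ... | + q | r , eX = termExponents (a ℕ.+ q ℕ.+ r ℕ.+ d′ ℕ.* X) (k⁺ ℕ.+ X ℕ.+ q)
    (trans E≡ (split a X (p u) q r (d′ ℕ.* X) eX)) (ℤP.pos-+ (k⁺ ℕ.+ X) q)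
  ... | -[1+ q ] | r , eX = termExponents (a ℕ.+ suc q ℕ.+ r ℕ.+ d′ ℕ.* X) (k⁺ ℕ.+ p u ℕ.+ r)
    (trans E≡ (split a X (p u) (suc q) r (d′ ℕ.* X) eX)) (negative k⁺ X (p u) q r eX)
    where
    negative : ∀ k⁺ x P q r → x ≡ P ℕ.+ suc q ℕ.+ r → + (k⁺ ℕ.+ P ℕ.+ r) ≡ + (k⁺ ℕ.+ x) ℤ.+ -[1+ q ]
    negative k⁺ x P q r refl =
      trans (add-sub (+ (k⁺ ℕ.+ P ℕ.+ r)) (+ suc q))
        (trans (cong (ℤ._+ -[1+ q ]) (sym (ℤP.pos-+ (k⁺ ℕ.+ P ℕ.+ r) (suc q))))
               (cong (λ z → + z ℤ.+ -[1+ q ]) (reassoc k⁺ P q r)))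
      where
      add-sub : ∀ a b → a ≡ a ℤ.+ b ℤ.+ ℤ.- b
      add-sub = solve-∀
      reassoc : ∀ k⁺ P q r → k⁺ ℕ.+ P ℕ.+ r ℕ.+ suc q ≡ k⁺ ℕ.+ (P ℕ.+ suc q ℕ.+ r)
      reassoc = ℕSolver.solve-∀
  forK : ∀ k → CommonExponents d′ k n p t
  forK (+ k⁺) = record { E = E ; M = k⁺ ℕ.+ X ; E+k≡dM = E+k≡dM ; term = term (d′ ℕ.* k⁺) k⁺ E refl }
    where
    E : ℕ
    E = d′ ℕ.* k⁺ ℕ.+ suc d′ ℕ.* X
    E+k≡dM : + E ℤ.+ + k⁺ ≡ + suc d′ ℤ.* + (k⁺ ℕ.+ X)
    E+k≡dM = trans (sym (ℤP.pos-+ E k⁺)) (trans (cong +_ (collect d′ k⁺ X)) (ℤP.pos-* (suc d′) (k⁺ ℕ.+ X)))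
      where
      collect : ∀ d′ k⁺ X → d′ ℕ.* k⁺ ℕ.+ suc d′ ℕ.* X ℕ.+ k⁺ ≡ suc d′ ℕ.* (k⁺ ℕ.+ X)
      collect = ℕSolver.solve-∀
  forK -[1+ k⁻ ] = record { E = E ; M = 0 ℕ.+ X ; E+k≡dM = E+k≡dM
                          ; term = term (suc k⁻) 0 E (ℕP.+-comm (suc d′ ℕ.* X) (suc k⁻)) }
    where
    E : ℕ
    E = suc d′ ℕ.* X ℕ.+ suc k⁻
    E+k≡dM : + E ℤ.+ -[1+ k⁻ ] ≡ + suc d′ ℤ.* + (0 ℕ.+ X)
    E+k≡dM = trans (cong (ℤ._+ -[1+ k⁻ ]) (ℤP.pos-+ (suc d′ ℕ.* X) (suc k⁻)))
               (trans (add-sub (+ (suc d′ ℕ.* X)) (+ suc k⁻)) (ℤP.pos-* (suc d′) X))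
      where
      add-sub : ∀ a b → a ℤ.+ b ℤ.+ ℤ.- b ≡ a
      add-sub = solve-∀

-- A zero (Y u) in 𝒪 of the normalised form ∑ 2^(h u) U_u y_u^d of f restricted to the variables φ u.
record NormalisedZero (d′ s : ℕ) (a : Fin s → K) (k : ℤ) : Set where
  field
    size : ℕ
    φ : Fin size → Fin s
    φ-injective : Injective _≡_ _≡_ φ
    h : Fin size → ℕ
    L : ∀ u → LevelWitness (suc d′) (a (φ u)) (k ℤ.+ + h u)
    Y : Fin size → Seq
    Y-coherent : ∀ u → Coherent (Y u)
    j : Fin size
    Y-j-odd : Y j 1 ≈[ + 2 ] 1ᴬ
    sum≈0 : ∀ n → ∑ᴬ size (λ u → 2^ᴬ (h u) ⊗ LevelWitness.U (L u) n ⊗ Y u n ^ᴬ suc d′) ≈[ two^ n ] 0ᴬ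

term-numerator : ∀ {d a k} (L : LevelWitness d a k) (Y : Seq) f E e h → E ≡ LevelWitness.p L ℕ.+ e →
  e ℕ.+ LevelWitness.q L ≡ den a ℕ.+ d ℕ.* f ℕ.+ h → ∀ n →
  2^ᴬ E ⊗ num (a *K ((Y /2^ f) ^K d)) n ≈[ two^ n ] 2^ᴬ (den (a *K ((Y /2^ f) ^K d))) ⊗ (2^ᴬ h ⊗ LevelWitness.U L n ⊗ Y n ^ᴬ d)
term-numerator {d} {a} L Y f E e h refl e+q≡ n =
  ≈-trans (≈-reflexive (trans (cong₂ _⊗_ (2^ᴬ-+ p e) (trans (num-*K a ((Y /2^ f) ^K d) n) (cong (num a n ⊗_) (num-^K (Y /2^ f) d n))))
                              (regroup₁ (2^ᴬ p) (2^ᴬ e) (num a n) (Y n ^ᴬ d))))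
    (≈-trans (⊗-congˡ (2^ᴬ e) (⊗-cong (scaled n) (≈-refl {Y n ^ᴬ d})))
      (≈-reflexive (begin
        2^ᴬ e ⊗ (2^ᴬ q ⊗ U n ⊗ Y n ^ᴬ d)     ≡⟨ regroup₂ (2^ᴬ e) (2^ᴬ q) (U n) (Y n ^ᴬ d) ⟩
        2^ᴬ e ⊗ 2^ᴬ q ⊗ U n ⊗ Y n ^ᴬ d       ≡⟨ cong (λ z → z ⊗ U n ⊗ Y n ^ᴬ d) (sym (2^ᴬ-+ e q)) ⟩
        2^ᴬ (e ℕ.+ q) ⊗ U n ⊗ Y n ^ᴬ d       ≡⟨ cong (λ z → 2^ᴬ z ⊗ U n ⊗ Y n ^ᴬ d) e+q≡ ⟩
        2^ᴬ (den a ℕ.+ d ℕ.* f ℕ.+ h) ⊗ U n ⊗ Y n ^ᴬ d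
          ≡⟨ cong (λ z → z ⊗ U n ⊗ Y n ^ᴬ d) (2^ᴬ-+ (den a ℕ.+ d ℕ.* f) h) ⟩
        2^ᴬ (den a ℕ.+ d ℕ.* f) ⊗ 2^ᴬ h ⊗ U n ⊗ Y n ^ᴬ d
          ≡⟨ regroup₃ (2^ᴬ (den a ℕ.+ d ℕ.* f)) (2^ᴬ h) (U n) (Y n ^ᴬ d) ⟩
        2^ᴬ (den a ℕ.+ d ℕ.* f) ⊗ (2^ᴬ h ⊗ U n ⊗ Y n ^ᴬ d)
          ≡⟨ cong (λ z → 2^ᴬ (den a ℕ.+ z) ⊗ (2^ᴬ h ⊗ U n ⊗ Y n ^ᴬ d)) (sym (den-^K (Y /2^ f) d)) ⟩
        2^ᴬ (den (a *K ((Y /2^ f) ^K d))) ⊗ (2^ᴬ h ⊗ U n ⊗ Y n ^ᴬ d) ∎)))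
  where
  open LevelWitness L
  open ≡-Reasoning
  regroup₁ : ∀ a b x y → a ⊗ b ⊗ (x ⊗ y) ≡ b ⊗ (a ⊗ x ⊗ y)
  regroup₁ = solve 4 (λ a b x y → a :* b :* (x :* y) := b :* (a :* x :* y)) refl
  regroup₂ : ∀ a b x y → a ⊗ (b ⊗ x ⊗ y) ≡ a ⊗ b ⊗ x ⊗ y
  regroup₂ = solve 4 (λ a b x y → a :* (b :* x :* y) := a :* b :* x :* y) refl
  regroup₃ : ∀ a b x y → a ⊗ b ⊗ x ⊗ y ≡ a ⊗ (b ⊗ x ⊗ y)
  regroup₃ = solve 4 (λ a b x y → a :* b :* x :* y := a :* (b :* x :* y)) refl

zero-term-numerator : ∀ a d′ E n →
  2^ᴬ E ⊗ num (a *K (0K ^K suc d′)) n ≈[ two^ n ] 2^ᴬ (den (a *K (0K ^K suc d′))) ⊗ 0ᴬ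
zero-term-numerator a d′ E n = ≈-reflexive (begin
  2^ᴬ E ⊗ num (a *K (0K ^K suc d′)) n
    ≡⟨ cong (2^ᴬ E ⊗_) (trans (num-*K a (0K ^K suc d′) n) (cong (num a n ⊗_) (num-^K 0K (suc d′) n))) ⟩
  2^ᴬ E ⊗ (num a n ⊗ 0ᴬ ^ᴬ suc d′)        ≡⟨ cong (λ z → 2^ᴬ E ⊗ (num a n ⊗ z)) (0^ᴬ-suc d′) ⟩
  2^ᴬ E ⊗ (num a n ⊗ 0ᴬ)                 ≡⟨ trans (cong (2^ᴬ E ⊗_) (⊗-zeroʳ (num a n))) (⊗-zeroʳ (2^ᴬ E)) ⟩
  0ᴬ                                     ≡⟨ sym (⊗-zeroʳ _) ⟩
  2^ᴬ (den (a *K (0K ^K suc d′))) ⊗ 0ᴬ ∎)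
  where open ≡-Reasoning

exponent-identity : ∀ e q E p D k h d M f t → E ≡ p ℤ.+ e → E ℤ.+ k ≡ d ℤ.* M → f ≡ M ℤ.+ t →
  q ≡ p ℤ.+ D ℤ.+ ((k ℤ.+ h) ℤ.+ d ℤ.* t) → e ℤ.+ q ≡ D ℤ.+ d ℤ.* f ℤ.+ h
exponent-identity e _ _ p D k h d M _ t refl E+k≡dM refl refl =
  trans (expand e p D k h d t) (trans (cong (λ z → z ℤ.+ D ℤ.+ h ℤ.+ d ℤ.* t) E+k≡dM) (collect D h d M t))
  where
  expand : ∀ e p D k h d t → e ℤ.+ (p ℤ.+ D ℤ.+ ((k ℤ.+ h) ℤ.+ d ℤ.* t)) ≡ p ℤ.+ e ℤ.+ k ℤ.+ D ℤ.+ h ℤ.+ d ℤ.* t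
  expand = solve-∀
  collect : ∀ D h d M t → d ℤ.* M ℤ.+ D ℤ.+ h ℤ.+ d ℤ.* t ≡ D ℤ.+ d ℤ.* (M ℤ.+ t) ℤ.+ h
  collect = solve-∀

module _ {d′ s} {a : Fin s → K} {k} (a-integral : ∀ i → IsK (a i)) (Z : NormalisedZero d′ s a k) where
  open NormalisedZero Z
  private
    d : ℕ
    d = suc d′
    module Lu u = LevelWitness (L u)
    module CE = CommonExponents (commonExponents d′ k size (λ u → Lu.p u) (λ u → Lu.t u))
    open CE using (E; M)

    f e : Fin size → ℕ
    f u = TermExponents.f (CE.term u)
    e u = TermExponents.e (CE.term u)

    e+q≡ : ∀ u → e u ℕ.+ Lu.q u ≡ den (a (φ u)) ℕ.+ d ℕ.* f u ℕ.+ h u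
    e+q≡ u = ℤP.+-injective (begin
      + (e u ℕ.+ Lu.q u)
        ≡⟨ ℤP.pos-+ (e u) (Lu.q u) ⟩
      + e u ℤ.+ + Lu.q u
        ≡⟨ exponent-identity (+ e u) (+ Lu.q u) (+ E) (+ Lu.p u) (+ den (a (φ u))) k (+ h u) (+ d) (+ M) (+ f u) (Lu.t u)
             (trans (cong +_ (TermExponents.E≡p+e (CE.term u))) (ℤP.pos-+ (Lu.p u) (e u)))
             CE.E+k≡dM (TermExponents.f≡M+t (CE.term u))
             (trans (Lu.q≡p+den+v u) (cong (λ z → + Lu.p u ℤ.+ + den (a (φ u)) ℤ.+ z) (Lu.v≡k+dt u))) ⟩
      + den (a (φ u)) ℤ.+ + d ℤ.* + f u ℤ.+ + h u
        ≡⟨ cong (λ z → + den (a (φ u)) ℤ.+ z ℤ.+ + h u) (sym (ℤP.pos-* d (f u))) ⟩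
      + den (a (φ u)) ℤ.+ + (d ℕ.* f u) ℤ.+ + h u
        ≡⟨ cong (ℤ._+ + h u) (sym (ℤP.pos-+ (den (a (φ u))) (d ℕ.* f u))) ⟩
      + (den (a (φ u)) ℕ.+ d ℕ.* f u) ℤ.+ + h u
        ≡⟨ sym (ℤP.pos-+ (den (a (φ u)) ℕ.+ d ℕ.* f u) (h u)) ⟩
      + (den (a (φ u)) ℕ.+ d ℕ.* f u ℕ.+ h u) ∎)
      where open ≡-Reasoning

    X : Fin size → K
    X u = Y u /2^ f u

    open Extend φ φ-injective

    extendK : ∀ {i} → Dec (∃ λ u → φ u ≡ i) → K
    extendK (yes (u , _)) = X u
    extendK (no _) = 0K

    x : Fin s → K
    x i = extendK (preimage? i)

    H : Fin size → ℕ → ZA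
    H u n = 2^ᴬ (h u) ⊗ Lu.U u n ⊗ Y u n ^ᴬ d

    extended-term : ∀ i (D : Dec (∃ λ u → φ u ≡ i)) n →
      2^ᴬ E ⊗ num (a i *K (extendK D ^K d)) n ≈[ two^ n ] 2^ᴬ (den (a i *K (extendK D ^K d))) ⊗ extendᴬ D (λ u → H u n)
    extended-term .(φ u) (yes (u , refl)) n = term-numerator (L u) (Y u) (f u) E (e u) (h u) (TermExponents.E≡p+e (CE.term u)) (e+q≡ u) n
    extended-term i (no _) n = zero-term-numerator (a i) d′ E n

    form-numerator : ∀ n → 2^ᴬ E ⊗ num (form d s a x) n ≈[ two^ n ] 2^ᴬ E ⊗ 0ᴬ
    form-numerator n =
      ≈-trans (sumK-num s (λ i → a i *K (x i ^K d)) (λ i → extendᴬ (preimage? i) (λ u → H u n)) E n (two^ n)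
                        (λ i → extended-term i (preimage? i) n))
        (≈-trans (≈-reflexive (cong (2^ᴬ (den (form d s a x)) ⊗_) (∑ᴬ-extend (λ u → H u n))))
          (≈-trans (⊗-congˡ _ (sum≈0 n)) (≈-reflexive (trans (⊗-zeroʳ _) (sym (⊗-zeroʳ (2^ᴬ E)))))))

    x-integral : ∀ i → IsK (x i)
    x-integral i = integral (preimage? i)
      where
      integral : ∀ (D : Dec (∃ λ u → φ u ≡ i)) → IsK (extendK D)
      integral (yes (u , _)) = Coherent⇒IsO (Y-coherent u)
      integral (no _) = Coherent⇒IsO (coherent-const 0ᴬ)

    form≈0 : form d s a x ≈K 0K
    form≈0 n = ≈⇒≡[modᴬ] (≈-trans (≈-reflexive (trans (sym (⊗-def (2^ᴬ 0) (num (form d s a x) n))) (⊗-identityˡ _)))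
      (≈-trans (cancel-2^ᴬ E (IsO⇒Coherent {num (form d s a x)} (isK-form d s a x a-integral x-integral)) (coherent-const 0ᴬ)
                           form-numerator n)
               (≈-reflexive (trans (sym (⊗-zeroʳ (2^ᴬ (den (form d s a x))))) (⊗-def _ 0ᴬ)))))

    X-j≉0 : ¬ (X j ≈K 0K)
    X-j≉0 X-j≈0 = 1≉0 (≈-trans (≈-sym Y-j-odd)
      (≈-trans (≈-reflexive (sym (trans (sym (⊗-def (2^ᴬ 0) (Y j 1))) (⊗-identityˡ _))))
        (≈-trans (≡[modᴬ]⇒≈ (X-j≈0 1)) (≈-reflexive (trans (sym (⊗-def (2^ᴬ (f j)) 0ᴬ)) (⊗-zeroʳ _))))))

    x-φj≉0 : ¬ (x (φ j) ≈K 0K)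
    x-φj≉0 = nonzero (preimage? (φ j))
      where
      nonzero : ∀ (D : Dec (∃ λ u → φ u ≡ φ j)) → ¬ (extendK D ≈K 0K)
      nonzero (yes (u , φu≡φj)) = subst (λ z → ¬ (X z ≈K 0K)) (sym (φ-injective φu≡φj)) X-j≉0
      nonzero (no ∄u) = ⊥-elim (∄u (j , refl))

  nontrivialZero : ∃ λ (x : Fin s → K) → (∀ i → IsK (x i)) × (∃ λ i → ¬ (x i ≈K 0K)) × (form (suc d′) s a x ≈K 0K)
  nontrivialZero = x , x-integral , (φ j , x-φj≉0) , form≈0

-- Lifting a zero modulo 8 by Hensel's lemma

record NormalisedResidueZero (d′ s : ℕ) (a : Fin s → K) (k : ℤ) : Set where
  field
    size : ℕ
    φ : Fin size → Fin s
    φ-injective : Injective _≡_ _≡_ φ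
    h : Fin size → ℕ
    L : ∀ u → LevelWitness (suc d′) (a (φ u)) (k ℤ.+ + h u)
    c : Fin size → ZA
    j : Fin size
    h-j≡0 : h j ≡ 0
    c-j-odd : c j ≈[ + 2 ] 1ᴬ
    sum≈0 : ∑ᴬ size (λ u → 2^ᴬ (h u) ⊗ LevelWitness.U (L u) 3 ⊗ c u ^ᴬ suc d′) ≈[ + 8 ] 0ᴬ

-- Only the j-th variable moves: it solves U_j y^d = -(the other terms), a d-th root problem.
module _ {m' s} {a : Fin s → K} {k} (m-odd : fromℤ (+ suc m') ≈[ + 2 ] 1ᴬ)
         (Z : NormalisedResidueZero (ℕ.pred (2 ℕ.* suc m')) s a k) where
  open NormalisedResidueZero Z
  private
    d : ℕ
    d = 2 ℕ.* suc m'
    module Lu u = LevelWitness (L u)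

    term : Fin size → ZA → ℕ → ZA
    term u y n = 2^ᴬ (h u) ⊗ Lu.U u n ⊗ y ^ᴬ d

    term-j : ∀ y n → term j y n ≡ Lu.U j n ⊗ y ^ᴬ d
    term-j y n = trans (cong (λ z → 2^ᴬ z ⊗ Lu.U j n ⊗ y ^ᴬ d) h-j≡0) (cong (_⊗ y ^ᴬ d) (⊗-identityˡ (Lu.U j n)))

    others : ℕ → ZA
    others n = ∑ᴬ size (λ u → when (¬? (u ≟ j)) (term u (c u) n))

    target : Seq
    target n = -ᴬ others n ⊗ Lu.W j n

    target-coherent : Coherent target
    target-coherent = coherent-⊗ {λ n → -ᴬ others n} {Lu.W j} (coherent-neg {others} others-coherent) (Lu.W-coherent j)
      where
      others-coherent : Coherent others
      others-coherent = coherent-∑ᴬ size (λ u n → when (¬? (u ≟ j)) (term u (c u) n)) coherent-when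
        where
        coherent-when : ∀ u → Coherent (λ n → when (¬? (u ≟ j)) (term u (c u) n))
        coherent-when u with ¬? (u ≟ j)
        ... | yes _ = coherent-⊗ {λ n → 2^ᴬ (h u) ⊗ Lu.U u n} (coherent-⊗ {λ _ → 2^ᴬ (h u)} (coherent-const _) (Lu.U-coherent u))
                                 (coherent-const _)
        ... | no _ = coherent-const 0ᴬ

    others≈ : others 3 ≈[ + 8 ] -ᴬ (Lu.U j 3 ⊗ c j ^ᴬ d)
    others≈ = ≈-trans (≈-reflexive (add-neg (term j (c j) 3) (others 3)))
      (≈-trans (⊕-cong (≈-trans (≈-reflexive (sym (∑ᴬ-split size (λ u → term u (c u) 3) j))) sum≈0) ≈-refl)
               (≈-reflexive (trans (⊕-identityˡ _) (cong -ᴬ_ (term-j (c j) 3)))))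
      where
      add-neg : ∀ f r → r ≡ f ⊕ r ⊕ -ᴬ f
      add-neg = solve 2 (λ f r → r := f :+ r :+ :- f) refl

    c-j-root : c j ^ᴬ d ≈[ + 8 ] target 3
    c-j-root = ≈-sym (≈-trans (⊗-cong (-ᴬ-cong others≈) (≈-refl {Lu.W j 3}))
      (≈-trans (≈-reflexive (regroup (Lu.U j 3) (c j ^ᴬ d) (Lu.W j 3)))
               (≈-trans (⊗-congˡ (c j ^ᴬ d) (Lu.UW≈1 j 3)) (≈-reflexive (⊗-identityʳ _)))))
      where
      regroup : ∀ u p w → -ᴬ (-ᴬ (u ⊗ p)) ⊗ w ≡ p ⊗ (u ⊗ w)
      regroup = solve 3 (λ u p w → :- (:- (u :* p)) :* w := p :* (u :* w)) refl

    open Hensel m' m-odd target target-coherent (c j) c-j-odd c-j-root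

    select : ∀ {u} → Dec (u ≡ j) → Seq → Seq
    select (yes _) y = root
    select (no _) y = y

    Y : Fin size → Seq
    Y u = select (u ≟ j) (λ _ → c u)

    Y-j : Y j ≡ root
    Y-j = selected (j ≟ j)
      where
      selected : (D : Dec (j ≡ j)) → select D (λ _ → c j) ≡ root
      selected (yes _) = refl
      selected (no j≢j) = ⊥-elim (j≢j refl)

    Y-coherent : ∀ u → Coherent (Y u)
    Y-coherent u with u ≟ j
    ... | yes _ = root-coherent
    ... | no _ = coherent-const _

    Y-others : ∀ n u → when (¬? (u ≟ j)) (term u (Y u n) n) ≡ when (¬? (u ≟ j)) (term u (c u) n)
    Y-others n u with u ≟ j
    ... | yes _ = refl
    ... | no _ = refl

    sum≈0′ : ∀ n → ∑ᴬ size (λ u → term u (Y u n) n) ≈[ two^ n ] 0ᴬ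
    sum≈0′ n = ≈-trans (≈-reflexive (begin
        ∑ᴬ size (λ u → term u (Y u n) n)
          ≡⟨ ∑ᴬ-split size (λ u → term u (Y u n) n) j ⟩
        term j (Y j n) n ⊕ ∑ᴬ size (λ u → when (¬? (u ≟ j)) (term u (Y u n) n))
          ≡⟨ cong₂ _⊕_ (trans (term-j (Y j n) n) (cong (λ y → Lu.U j n ⊗ y n ^ᴬ d) Y-j)) (∑ᴬ-ext size (Y-others n)) ⟩
        Lu.U j n ⊗ root n ^ᴬ d ⊕ others n ∎))
      (≈-trans (⊕-cong (⊗-congˡ (Lu.U j n) (root-^ n)) (≈-refl {others n}))
        (≈-trans (≈-reflexive (regroup (Lu.U j n) (others n) (Lu.W j n)))
          (≈-trans (⊕-cong (⊗-congˡ (-ᴬ others n) (Lu.UW≈1 j n)) (≈-refl {others n})) (≈-reflexive (cancel (others n))))))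
      where
      open ≡-Reasoning
      regroup : ∀ u r w → u ⊗ (-ᴬ r ⊗ w) ⊕ r ≡ -ᴬ r ⊗ (u ⊗ w) ⊕ r
      regroup = solve 3 (λ u r w → u :* (:- r :* w) :+ r := :- r :* (u :* w) :+ r) refl
      cancel : ∀ r → -ᴬ r ⊗ 1ᴬ ⊕ r ≡ 0ᴬ
      cancel = solve 1 (λ r → :- r :* con (+ 1) :+ r := con (+ 0)) refl

  henselLift : NormalisedZero (ℕ.pred (2 ℕ.* suc m')) s a k
  henselLift = record
    { size = size ; φ = φ ; φ-injective = φ-injective ; h = h ; L = L ; Y = Y ; Y-coherent = Y-coherent ; j = j
    ; Y-j-odd = subst (λ y → y 1 ≈[ + 2 ] 1ᴬ) (sym Y-j) (root-odd 1) ; sum≈0 = sum≈0′ }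

√5 : ZA
√5 = (-[1+ 0 ] , + 2)

residueRoot : Fin 3 → ZA
residueRoot fzero = 0ᴬ
residueRoot (fsuc fzero) = 1ᴬ
residueRoot (fsuc (fsuc fzero)) = √5

opaque
  unfolding _⊗_ _⊕_

  √5-square : √5 ⊗ √5 ≡ fromℤ (+ 5)
  √5-square = refl

  √5-odd : √5 ≈[ + 2 ] 1ᴬ
  √5-odd = (-[1+ 0 ] , + 1) , refl

residueRoot-odd : ∀ x → ¬ (x ≡ fzero) → residueRoot x ≈[ + 2 ] 1ᴬ
residueRoot-odd fzero x≢0 = ⊥-elim (x≢0 refl)
residueRoot-odd (fsuc fzero) _ = ≈-refl
residueRoot-odd (fsuc (fsuc fzero)) _ = √5-odd

odd-≈1 : ∀ m t → m ≡ suc (t ℕ.+ t) → fromℤ (+ m) ≈[ + 2 ] 1ᴬ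
odd-≈1 m t refl = fromℤ (+ t) , trans (fromℤ-+-ℕ 1 (t ℕ.+ t)) (cong (1ᴬ ⊕_) double)
  where
  double : fromℤ (+ (t ℕ.+ t)) ≡ fromℤ (+ 2) ⊗ fromℤ (+ t)
  double = trans (cong (λ u → fromℤ (+ (t ℕ.+ u))) (sym (ℕP.+-identityʳ t))) (fromℤ-*-ℕ 2 t)

-- 5² ≡ 1 (mod 8), so 5^m ≡ 5 for odd m.
5^odd : ∀ t → fromℤ (+ 5) ^ᴬ suc (t ℕ.+ t) ≈[ + 8 ] fromℤ (+ 5)
5^odd t = ≈-trans (⊗-congˡ (fromℤ (+ 5)) even-power) (≈-reflexive (⊗-identityʳ _))
  where
  25≈1 : fromℤ (+ 5) ⊗ fromℤ (+ 5) ≡ 1ᴬ ⊕ fromℤ (+ 8) ⊗ fromℤ (+ 3)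
  25≈1 = solve 0 (con (+ 5) :* con (+ 5) := con (+ 1) :+ con (+ 8) :* con (+ 3)) refl
  even-power : fromℤ (+ 5) ^ᴬ (t ℕ.+ t) ≈[ + 8 ] 1ᴬ
  even-power = ≈-trans (≈-reflexive (trans (cong (λ z → fromℤ (+ 5) ^ᴬ (t ℕ.+ z)) (sym (ℕP.+-identityʳ t)))
                                           (^ᴬ-2* (fromℤ (+ 5)) t)))
                       (≈-trans (^ᴬ-cong t (fromℤ (+ 3) , 25≈1)) (≈-reflexive (1^ᴬ t)))

residueRoot-power : ∀ m t → m ≡ suc (t ℕ.+ t) → ∀ x → residueRoot x ^ᴬ (2 ℕ.* m) ≈[ + 8 ] powerResidue x
residueRoot-power _ t refl fzero = ≈-reflexive (⊗-zeroˡ _)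
residueRoot-power m t m≡ (fsuc fzero) = ≈-reflexive (1^ᴬ (2 ℕ.* m))
residueRoot-power m t m≡ (fsuc (fsuc fzero)) =
  ≈-trans (≈-reflexive (trans (^ᴬ-2* √5 m) (trans (cong (_^ᴬ m) √5-square) (cong (fromℤ (+ 5) ^ᴬ_) m≡)))) (5^odd t)

bitᴬ-power : ∀ b n → bitᴬ b ^ᴬ suc n ≡ bitᴬ b
bitᴬ-power false n = 0^ᴬ-suc n
bitᴬ-power true n = trans (⊗-identityˡ _) (1^ᴬ n)

level-subst : ∀ {d a k k′} → k ≡ k′ → LevelWitness d a k → LevelWitness d a k′
level-subst {d} k≡k′ L = record
  { U = U ; W = W ; U-coherent = U-coherent ; W-coherent = W-coherent ; UW≈1 = UW≈1 ; p = p ; q = q ; scaled = scaled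
  ; v = v ; t = t ; q≡p+den+v = q≡p+den+v ; v≡k+dt = trans v≡k+dt (cong (ℤ._+ + d ℤ.* t) k≡k′) }
  where open LevelWitness L

module _ (m' t : ℕ) (m≡2t+1 : suc m' ≡ suc (t ℕ.+ t)) {s} (a : Fin s → K) (k : ℤ) (c : ZA) (c≉0 : ¬ (c ≈[ + 2 ] 0ᴬ))
         (ι : Fin 6 → Fin s) (ι-injective : Injective _≡_ _≡_ ι)
         (ι-level : ∀ i → HasLevelClass (2 ℕ.* suc m') (a (ι i)) k c)
         (i₀ : Fin s) (i₀-level : HasLevel (2 ℕ.* suc m') (a i₀) (k ℤ.+ + 1)) where
  private
    d : ℕ
    d = 2 ℕ.* suc m'

    Lι-class : ∀ i → Σ (LevelWitness d (a (ι i)) k) λ L → LevelWitness.U L 1 ≈[ + 2 ] c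
    Lι-class i = HasLevelClass⇒LevelWitness {d} {a (ι i)} {k} {c} (ι-level i)

    Lι : ∀ i → LevelWitness d (a (ι i)) k
    Lι i = proj₁ (Lι-class i)

    L₀ : LevelWitness d (a i₀) (k ℤ.+ + 1)
    L₀ = HasLevel⇒LevelWitness {d} {a i₀} i₀-level

    ι≢i₀ : ∀ i → ¬ (ι i ≡ i₀)
    ι≢i₀ i ιi≡i₀ = levels-distinct 2≤d (subst (λ i → LevelWitness d (a i) k) ιi≡i₀ (Lι i)) L₀
      where
      2≤d : 2 ℕ.≤ d
      2≤d = ℕP.*-monoʳ-≤ 2 (ℕ.s≤s ℕ.z≤n)

    σ : Fin 6 → ZA
    σ i = LevelWitness.U (Lι i) 3

    σ≈c : ∀ i → σ i ≈[ + 2 ] c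
    σ≈c i = ≈-trans (coherent-≤ (LevelWitness.U-coherent (Lι i)) 1 3 (ℕ.s≤s ℕ.z≤n)) (proj₂ (Lι-class i))

    w : ZA
    w = LevelWitness.U L₀ 3

    w≉0 : ¬ (w ≈[ + 2 ] 0ᴬ)
    w≉0 w≈0 = unit-odd {LevelWitness.U L₀} {LevelWitness.W L₀} (LevelWitness.UW≈1 L₀)
                 (≈-trans (≈-sym (coherent-≤ (LevelWitness.U-coherent L₀) 1 3 (ℕ.s≤s ℕ.z≤n))) w≈0)

    open ResidueSolution (residueSolution σ c w σ≈c c≉0 w≉0)

    φ : Fin 7 → Fin s
    φ fzero = i₀
    φ (fsuc i) = ι (π i)

    φ-injective : Injective _≡_ _≡_ φ
    φ-injective {fzero} {fzero} _ = refl
    φ-injective {fzero} {fsuc y} eq = ⊥-elim (ι≢i₀ (π y) (sym eq))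
    φ-injective {fsuc x} {fzero} eq = ⊥-elim (ι≢i₀ (π x) eq)
    φ-injective {fsuc x} {fsuc y} eq = cong fsuc (π-injective (ι-injective eq))

    h : Fin 7 → ℕ
    h fzero = 1
    h (fsuc _) = 0

    L : ∀ u → LevelWitness d (a (φ u)) (k ℤ.+ + h u)
    L fzero = L₀
    L (fsuc i) = level-subst (sym (ℤP.+-identityʳ k)) (Lι (π i))

    y₀ : Fin 7 → ZA
    y₀ fzero = bitᴬ δ
    y₀ (fsuc i) = residueRoot (e i)

    sum≈0′ : ∑ᴬ 7 (λ u → 2^ᴬ (h u) ⊗ LevelWitness.U (L u) 3 ⊗ y₀ u ^ᴬ d) ≈[ + 8 ] 0ᴬ
    sum≈0′ = ≈-trans
      (⊕-cong (≈-reflexive (trans (cong (fromℤ (+ 2) ⊗ w ⊗_) (bitᴬ-power δ (ℕ.pred d))) (⊗-comm _ (bitᴬ δ))))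
              (∑ᴬ-cong 6 λ i → ≈-trans (≈-reflexive (cong (_⊗ residueRoot (e i) ^ᴬ d) (⊗-identityˡ (σ (π i)))))
                                       (⊗-congˡ (σ (π i)) (residueRoot-power (suc m') t m≡2t+1 (e i)))))
      (≈-trans (≈-reflexive (⊕-comm _ _)) sum≈0)

  residueZero : NormalisedResidueZero (ℕ.pred (2 ℕ.* suc m')) s a k
  residueZero = record
    { size = 7 ; φ = φ ; φ-injective = φ-injective ; h = h ; L = L ; c = y₀ ; j = fsuc j ; h-j≡0 = refl
    ; c-j-odd = residueRoot-odd (e j) e-j≢0 ; sum≈0 = sum≈0′ }

odd⇒2t+1 : ∀ m → m % 2 ≡ 1 → m ≡ suc (m ℕ./ 2 ℕ.+ m ℕ./ 2)
odd⇒2t+1 m m%2≡1 =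
  trans (ℕDM.m≡m%n+[m/n]*n m 2) (trans (cong (ℕ._+ m ℕ./ 2 ℕ.* 2) m%2≡1) (double (m ℕ./ 2)))
  where
  double : ∀ t → 1 ℕ.+ t ℕ.* 2 ≡ suc (t ℕ.+ t)
  double = ℕSolver.solve-∀

lemma18 : (m : ℕ) → 3 ≤ m → m % 2 ≡ 1 →
    (s : ℕ) (a : Fin s → K) → (∀ i → IsK (a i)) →
    (k : ℤ) (c : ZA) → ¬ (c ≡ 0ᴬ [modᴬ + 2 ]) →
    (∃ λ (ι : Fin 6 → Fin s) → Injective _≡_ _≡_ ι × (∀ j → HasLevelClass (2 * m) (a (ι j)) k c)) →
    (∃ λ i → HasLevel (2 * m) (a i) (k +ℤ + 1)) →
    ∃ λ (x : Fin s → K) → (∀ i → IsK (x i)) × (∃ λ i → ¬ (x i ≈K 0K)) × (form (2 * m) s a x ≈K 0K)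
lemma18 zero _ () s a a-integral k c c≢0 _ _
lemma18 (suc m') _ m-odd s a a-integral k c c≢0 (ι , ι-injective , ι-level) (i₀ , i₀-level) =
  nontrivialZero a-integral (henselLift (odd-≈1 (suc m') t m≡2t+1)
    (residueZero m' t m≡2t+1 a k c (λ c≈0 → c≢0 (≈⇒≡[modᴬ] c≈0)) ι ι-injective ι-level i₀ i₀-level))
  where
  t : ℕ
  t = suc m' ℕ./ 2
  m≡2t+1 : suc m' ≡ suc (t ℕ.+ t)
  m≡2t+1 = odd⇒2t+1 (suc m') m-odd
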